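{- Let $q$ be a prime power, $G=\mathrm{GL}_n(\mathbb{F}_q)$, $\sigma\in\mathfrak{S}_n$, and suppose $hB\in[\sigma]$. Then for $1\le i\le n-1$: if $\sigma_{i+1}<\sigma_i$, then $(hB)\cdot T_i=\sum_{j=1}^q g_jB$ for some pairwise distinct cosets $g_jB\in[\sigma s_i]$; if $\sigma_{i+1}>\sigma_i$, then $(hB)\cdot T_i=gB+\sum_{j=1}^{q-1}h_jB$ for some $gB\in[\sigma s_i]$ and pairwise distinct $h_jB\in[\sigma]$. Moreover, \[ \Big(\sum_{hB\in[\sigma]}hB\Big)\cdot T_i=\begin{cases}\sum_{gB\in[\sigma s_i]}gB & \text{if }\sigma_{i+1}<\sigma_i,\\ q\sum_{gB\in[\sigma s_i]}gB+(q-1)\sum_{hB\in[\sigma]}hB & \text{if }\sigma_{i+1}>\sigma_i.\end{cases} \]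
   Context: $B$ is the subgroup of invertible upper triangular matrices and $B^-$ that of invertible lower triangular matrices in $G$. For $\sigma\in\mathfrak{S}_n$ (one-line notation) let $P_\sigma$ be the permutation matrix with $1$ in entries $(\sigma_j,j)$, and $[\sigma]$ the set of left cosets $gB$ with $g\in B^-P_\sigma B$. $\sigma s_i$ denotes $\sigma$ with the entries in positions $i,i+1$ swapped, and $s_i$ also denotes the corresponding permutation matrix (right multiplication by it swaps columns $i,i+1$). For $t\in\mathbb{F}_q$, $f_i(t)$ is the identity matrix with an extra entry $t$ in position $(i+1,i)$. The Hecke generators act on the complex vector space with basis $G/B$ on the right by $(gB)\cdot T_i=gs_iB+\sum_{t\in\mathbb{F}_q,\,t\ne0}gf_i(t)B$. -}

module Defs where

open import Level using (Level; _⊔_)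
open import Algebra.Bundles using (CommutativeRing)
open import Data.Nat as ℕ using (ℕ; _^_; _≥_)
open import Data.Nat.Primality using (Prime)
open import Data.Fin as Fin using (Fin; zero; suc; inject₁; toℕ; _≟_)
open import Data.Fin.Permutation using (Permutation′; _⟨$⟩ʳ_; transpose; _∘ₚ_)
open import Data.List using (List; []; _∷_; length; filter; map; concatMap)
open import Data.List.Membership.Setoid using ()
open import Data.List.Relation.Unary.Any using (Any)
open import Data.List.Relation.Unary.All using (All)
open import Data.List.Relation.Unary.AllPairs using (AllPairs)
open import Data.List.Relation.Binary.Permutation.Homogeneous using (Permutation)
open import Data.Product using (Σ; ∃; _×_; _,_)
open import Relation.Nullary using (¬_; yes; no)
open import Relation.Nullary.Decidable using (¬?)
open import Relation.Binary using (Rel; Decidable)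
open import Relation.Unary using (Pred)
open import Relation.Binary.PropositionalEquality using (_≡_)

IsPrimePower : ℕ → Set
IsPrimePower q = Σ ℕ λ p → Σ ℕ λ k → Prime p × k ≥ 1 × q ≡ p ^ k

record FiniteField (c ℓ : Level) : Set (Level.suc (c ⊔ ℓ)) where
  field
    cring     : CommutativeRing c ℓ
  open CommutativeRing cring public
  field
    _≟F_      : Decidable _≈_
    1≉0       : ¬ (1# ≈ 0#)
    inverse   : ∀ x → ¬ (x ≈ 0#) → Σ Carrier λ y → x * y ≈ 1#
    elements  : List Carrier
    complete  : ∀ x → Any (x ≈_) elements
    distinct  : AllPairs (λ x y → ¬ (x ≈ y)) elements

  size : ℕ
  size = length elements

  nonzero : List Carrier
  nonzero = filter (λ t → ¬? (t ≟F 0#)) elements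

-- GL_n(F_q) with n = suc m; indices are 0-based, so the paper's
-- position i (1 ≤ i ≤ n-1) is  inject₁ i  and position i+1 is  suc i,  for i : Fin m.
module Hecke {c ℓ : Level} (F : FiniteField c ℓ) (m : ℕ) where
  open FiniteField F using (Carrier; _≈_; _+_; _*_; 0#; 1#; nonzero)

  n : ℕ
  n = ℕ.suc m

  Mat : Set c
  Mat = Fin n → Fin n → Carrier

  _≈M_ : Rel Mat ℓ
  A ≈M B = ∀ i j → A i j ≈ B i j

  ∑ : ∀ {k} → (Fin k → Carrier) → Carrier
  ∑ {ℕ.zero} f = 0#
  ∑ {ℕ.suc k} f = f zero + ∑ (λ j → f (suc j))

  _·_ : Mat → Mat → Mat
  (A · B) i j = ∑ λ k → A i k * B k j

  δ : Fin n → Fin n → Carrier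
  δ i j with i ≟ j
  ... | yes _ = 1#
  ... | no  _ = 0#

  I : Mat
  I = δ

  Invertible : Pred Mat (c ⊔ ℓ)
  Invertible A = Σ Mat λ A⁻¹ → (A · A⁻¹) ≈M I × (A⁻¹ · A) ≈M I

  UpperTriangular LowerTriangular : Pred Mat ℓ
  UpperTriangular A = ∀ i j → j Fin.< i → A i j ≈ 0#
  LowerTriangular A = ∀ i j → i Fin.< j → A i j ≈ 0#

  InB InB⁻ : Pred Mat (c ⊔ ℓ)
  InB A  = Invertible A × UpperTriangular A
  InB⁻ A = Invertible A × LowerTriangular A

  P : Permutation′ n → Mat
  P σ i j = δ i (σ ⟨$⟩ʳ j)

  -- σ s_i : swap the entries of σ in positions i, i+1
  _s_ : Permutation′ n → Fin m → Permutation′ n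
  σ s i = transpose (inject₁ i) (suc i) ∘ₚ σ

  sM : Fin m → Mat
  sM i = P (transpose (inject₁ i) (suc i))

  f : Fin m → Carrier → Mat
  f i t r k with r ≟ suc i | k ≟ inject₁ i
  ... | yes _ | yes _ = t
  ... | _     | _     = δ r k

  _~_ : Rel Mat (c ⊔ ℓ)
  g ~ g' = Σ Mat λ b → InB b × g' ≈M (g · b)

  -- g ∈ B⁻ P_σ B, i.e. gB ∈ [σ]
  InCell : Permutation′ n → Pred Mat (c ⊔ ℓ)
  InCell σ g = Σ Mat λ b⁻ → Σ Mat λ b → InB⁻ b⁻ × InB b × g ≈M ((b⁻ · P σ) · b)

  -- A formal sum of cosets with nonnegative integer coefficients is
  -- represented by a list of representatives (with repetition).
  -- Two such sums are equal in ℂ[G/B] iff the lists agree up to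
  -- reordering and replacing representatives of the same coset.
  _≐_ : Rel (List Mat) (c ⊔ ℓ)
  _≐_ = Permutation _~_

  T₁ : Fin m → Mat → List Mat
  T₁ i g = (g · sM i) ∷ map (λ t → g · f i t) nonzero

  T : Fin m → List Mat → List Mat
  T i = concatMap (T₁ i)

  _⊛_ : ℕ → List Mat → List Mat
  ℕ.zero  ⊛ L = []
  ℕ.suc k ⊛ L = L Data.List.++ (k ⊛ L)

  Reps : Permutation′ n → Pred (List Mat) (c ⊔ ℓ)
  Reps σ R = All (InCell σ) R × AllPairs (λ a b → ¬ (a ~ b)) R
             × (∀ g → InCell σ g → Any (g ~_) R)

{-# OPTIONS --safe #-}
module Submission where

open import Defs
open import Level using (Level; _⊔_; Lift; lift)
open import Algebra.Bundles using (CommutativeMonoid)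
import Algebra.Properties.CommutativeMonoid.Mult as Mult
import Algebra.Properties.CommutativeSemigroup as CommutativeSemigroupProperties
import Algebra.Properties.Ring as RingProperties
open import Data.Empty using (⊥; ⊥-elim)
open import Data.Unit using (⊤; tt)
open import Data.Product using (Σ; ∃₂; _×_; _,_; proj₁; proj₂)
open import Data.Sum using (_⊎_; inj₁; inj₂)
open import Data.Nat as ℕ using (ℕ; zero; suc; _∸_)
import Data.Nat.Properties as ℕP
open import Data.Fin as Fin using (Fin; zero; suc; toℕ; inject₁; _≟_; _<_)
open import Data.Fin using () renaming (suc to fsuc)
import Data.Fin.Properties as FinP
open import Data.Fin.Permutation as Perm using (Permutation′; _⟨$⟩ʳ_; _⟨$⟩ˡ_; _∘ₚ_)
import Data.Fin.Permutation.Components as PC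
open import Data.List using (List; []; _∷_; _++_; [_]; length; map; filter; concatMap)
import Data.List.Properties as List
open import Data.List.Relation.Unary.All as All using (All; []; _∷_)
import Data.List.Relation.Unary.All.Properties as AllProperties
open import Data.List.Relation.Unary.Any as Any using (Any; here; there)
import Data.List.Relation.Unary.Any.Properties as AnyProperties
open import Data.List.Relation.Unary.AllPairs as AllPairs using (AllPairs; []; _∷_)
import Data.List.Relation.Unary.AllPairs.Properties as AllPairsProperties
import Data.List.Relation.Unary.Unique.Setoid as UniqueSetoid
import Data.List.Membership.Setoid as Membership
import Data.List.Membership.Setoid.Properties as MembershipProperties
open import Data.List.Relation.Binary.Pointwise as Pointwise using (Pointwise)
import Data.List.Relation.Binary.Permutation.Homogeneous as Homogeneous
import Data.List.Relation.Binary.Permutation.Setoid as Permutation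
import Data.List.Relation.Binary.Permutation.Setoid.Properties as PermutationProperties
open import Function using (_∘_)
open import Relation.Binary.Bundles using (Setoid)
open import Relation.Binary.Definitions using (Tri; tri<; tri≈; tri>)
open import Relation.Binary.PropositionalEquality as ≡ using (_≡_; _≢_)
import Relation.Binary.Reasoning.Setoid as SetoidReasoning
open import Relation.Nullary using (¬_; Dec; yes; no)
open import Relation.Nullary.Decidable using (¬?)

-- Fix i and let P_i = B ∪ B s_i B. For invertible g the q + 1 cosets gB, g s_i B and g f_i(t) B
-- (t ≠ 0) are distinct and are exactly the cosets inside g P_i, a projective line over F_q: (gB) · T_i
-- is the sum of its q points other than gB, and the line is the same for each of its points.
-- Writing g = b⁻ P_σ, the point g s_i lies in [σ s_i], while g f_i(t) lies in [σ] if σ_i < σ_{i+1}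
-- (conjugation by P_σ keeps f_i(t) in B⁻) and in [σ s_i] otherwise (f_i(t) = s_i f_i(t⁻¹) b);
-- the two cells are disjoint. For a descent each line therefore meets [σ] in a single point, so the
-- lines through [σ] partition [σ s_i] and (Σ [σ]) · T_i = Σ [σ s_i]. For an ascent, apply this to
-- σ s_i and expand with the quadratic relation T_i² = q + (q - 1) T_i, which also follows from the lines.

concatMap-concatMap : ∀ {a} {A : Set a} (f g : A → List A) xs →
                      concatMap f (concatMap g xs) ≡ concatMap (concatMap f ∘ g) xs
concatMap-concatMap f g []       = ≡.refl
concatMap-concatMap f g (x ∷ xs) = ≡.trans (List.concatMap-++ f (g x) (concatMap g xs))
                                           (≡.cong (concatMap f (g x) ++_) (concatMap-concatMap f g xs))

AllPairs-mapWithAll : ∀ {a p r s} {A : Set a} {P : A → Set p} {R : A → A → Set r} {S : A → A → Set s} →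
                      (∀ {x y} → P x → P y → R x y → S x y) → ∀ {xs} → All P xs → AllPairs R xs → AllPairs S xs
AllPairs-mapWithAll f []         []           = []
AllPairs-mapWithAll f (px ∷ pxs) (Rx ∷ Rxs) = All.zipWith (λ (py , Rxy) → f px py Rxy) (pxs , Rx) ∷ AllPairs-mapWithAll f pxs Rxs

module SetoidLists {a ℓ : Level} (S : Setoid a ℓ) where
  open Setoid S renaming (Carrier to A)
  open Permutation S public hiding (refl; trans)
  open PermutationProperties S public
  open UniqueSetoid S public using (Unique)
  open Membership S public using (_∈_)
  open Mult ++-commutativeMonoid public using (×-congʳ; ×-distrib-+) renaming (_×_ to _times_)
  open CommutativeSemigroupProperties (CommutativeMonoid.commutativeSemigroup ++-commutativeMonoid)
    using (interchange)

  ∈⇒↭∷ : ∀ {x ys} → x ∈ ys → ∃₂ λ y ys′ → x ≈ y × ys ↭ y ∷ ys′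
  ∈⇒↭∷ x∈ys with MembershipProperties.∈-∃++ S x∈ys
  ... | B , C , y , x≈y , ys≋ = y , B ++ C , x≈y , ↭-trans (↭-reflexive-≋ ys≋) (↭-shift B C)

  unique-⊆-⊇⇒↭ : ∀ {xs ys} → Unique xs → Unique ys → All (_∈ ys) xs → All (_∈ xs) ys → xs ↭ ys
  unique-⊆-⊇⇒↭ {[]} {[]}    _ _ _ _        = ↭-refl
  unique-⊆-⊇⇒↭ {[]} {_ ∷ _} _ _ _ (() ∷ _)
  unique-⊆-⊇⇒↭ {x ∷ xs} (x≉xs ∷ xs!) ys! (x∈ys ∷ xs⊆ys) ys⊆x∷xs with ∈⇒↭∷ x∈ys
  ... | y , ys′ , x≈y , ys↭ = ↭-trans (prep x≈y (unique-⊆-⊇⇒↭ xs! ys′! xs⊆ys′ ys′⊆xs)) (↭-sym ys↭)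
    where
    y≉ys′ : All (λ z → ¬ y ≈ z) ys′
    y≉ys′ = AllPairs.head (Unique-resp-↭ ys↭ ys!)
    ys′! : Unique ys′
    ys′! = AllPairs.tail (Unique-resp-↭ ys↭ ys!)
    xs⊆ys′ : All (_∈ ys′) xs
    xs⊆ys′ = All.zipWith (λ (x≉z , z∈ys) → Any.tail (λ z≈y → x≉z (trans x≈y (sym z≈y))) (∈-resp-↭ ys↭ z∈ys))
                         (x≉xs , xs⊆ys)
    ys′⊆xs : All (_∈ xs) ys′
    ys′⊆xs = All.zipWith (λ (y≉z , z∈x∷xs) → Any.tail (λ z≈x → y≉z (trans (sym x≈y) (sym z≈x))) z∈x∷xs)
                         (y≉ys′ , All.tail (All-resp-↭ (MembershipProperties.∈-resp-≈ S) ys↭ ys⊆x∷xs))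

  times-[] : ∀ k → k times [] ≡ []
  times-[] zero    = ≡.refl
  times-[] (suc k) = times-[] k

  module _ {b} {B : Set b} where

    concatMap⁺ : ∀ {F G : B → List A} xs → All (λ x → F x ↭ G x) xs → concatMap F xs ↭ concatMap G xs
    concatMap⁺ []       []       = ↭-refl
    concatMap⁺ (x ∷ xs) (p ∷ ps) = ++⁺ p (concatMap⁺ xs ps)

    concatMap-++ : ∀ (F G : B → List A) xs → concatMap (λ x → F x ++ G x) xs ↭ concatMap F xs ++ concatMap G xs
    concatMap-++ F G []       = ↭-refl
    concatMap-++ F G (x ∷ xs) = ↭-trans (++⁺ˡ (F x ++ G x) (concatMap-++ F G xs))
                                        (interchange (F x) (G x) (concatMap F xs) (concatMap G xs))

    concatMap-times : ∀ k (F : B → List A) xs → concatMap (λ x → k times F x) xs ↭ k times concatMap F xs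
    concatMap-times k F []       = ↭-reflexive (≡.sym (times-[] k))
    concatMap-times k F (x ∷ xs) = ↭-trans (++⁺ˡ (k times F x) (concatMap-times k F xs))
                                           (↭-sym (×-distrib-+ (F x) (concatMap F xs) k))

  concatMap-resp-↭ : ∀ {q} {Q : A → Set q} (F : A → List A) → (∀ {x y} → x ≈ y → Q x → Q y) →
                     (∀ {x y} → Q x → x ≈ y → F x ↭ F y) → ∀ {xs ys} → All Q xs → xs ↭ ys → concatMap F xs ↭ concatMap F ys
  concatMap-resp-↭ {Q = Q} F Q-resp F-resp = go
    where
    go : ∀ {xs ys} → All Q xs → xs ↭ ys → concatMap F xs ↭ concatMap F ys
    go Qxs (Homogeneous.refl xs≋ys) = pointwise Qxs xs≋ys
      where
      pointwise : ∀ {xs ys} → All Q xs → Pointwise _≈_ xs ys → concatMap F xs ↭ concatMap F ys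
      pointwise []         Pointwise.[]               = ↭-refl
      pointwise (Qx ∷ Qxs) (x≈y Pointwise.∷ xs≋ys) = ++⁺ (F-resp Qx x≈y) (pointwise Qxs xs≋ys)
    go (Qx ∷ Qxs) (Homogeneous.prep x≈y xs↭ys) = ++⁺ (F-resp Qx x≈y) (go Qxs xs↭ys)
    go (Qx ∷ Qy ∷ Qxs) (Homogeneous.swap {x = x} {y = y} x≈x′ y≈y′ xs↭ys) =
      ↭-trans (shifts (F x) (F y)) (++⁺ (F-resp Qy y≈y′) (++⁺ (F-resp Qx x≈x′) (go Qxs xs↭ys)))
    go Qxs (Homogeneous.trans xs↭ys ys↭zs) = ↭-trans (go Qxs xs↭ys) (go (All-resp-↭ Q-resp xs↭ys Qxs) ys↭zs)

  concatMap-const : ∀ {b} {B : Set b} (ys : List A) (xs : List B) → concatMap (λ _ → ys) xs ≡ length xs times ys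
  concatMap-const ys []       = ≡.refl
  concatMap-const ys (x ∷ xs) = ≡.cong (ys ++_) (concatMap-const ys xs)

  -- F x is the complement of x in g ∷ X, so concatenating over X counts g once for each
  -- element of X and each element of X once for each of the others.
  concatMap-complements : ∀ (F : A → List A) g X → All (λ x → x ∷ F x ↭ g ∷ X) X →
                          concatMap F X ↭ length X times [ g ] ++ (length X ∸ 1) times X
  concatMap-complements F g X complements = dropMiddle [] [] (begin
    X ++ concatMap F X                                   ≡⟨ ≡.cong (_++ concatMap F X) (List.concatMap-pure X) ⟨
    concatMap [_] X ++ concatMap F X                     ↭⟨ concatMap-++ [_] F X ⟨
    concatMap (λ x → x ∷ F x) X                          ↭⟨ concatMap⁺ X complements ⟩
    concatMap (λ _ → g ∷ X) X                            ≡⟨ concatMap-const (g ∷ X) X ⟩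
    length X times ([ g ] ++ X)                          ↭⟨ ×-distrib-+ [ g ] X (length X) ⟩
    length X times [ g ] ++ length X times X             ≡⟨ ≡.cong (length X times [ g ] ++_) (unfold X) ⟩
    length X times [ g ] ++ X ++ (length X ∸ 1) times X  ↭⟨ shifts (length X times [ g ]) X ⟩
    X ++ length X times [ g ] ++ (length X ∸ 1) times X  ∎)
    where
    open PermutationReasoning
    unfold : ∀ X → length X times X ≡ X ++ (length X ∸ 1) times X
    unfold []      = ≡.refl
    unfold (_ ∷ _) = ≡.refl

module Matrices {c ℓ : Level} (F : FiniteField c ℓ) (m : ℕ) where
  open FiniteField F hiding (zero)
  open Hecke F m
  open SetoidReasoning setoid
  open CommutativeSemigroupProperties +-commutativeSemigroup using (interchange)
  open CommutativeSemigroupProperties *-commutativeSemigroup using (x∙yz≈xz∙y)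

  ∑-cong : ∀ {k} {f g : Fin k → Carrier} → (∀ j → f j ≈ g j) → ∑ f ≈ ∑ g
  ∑-cong {zero}  f≈g = refl
  ∑-cong {suc k} f≈g = +-cong (f≈g zero) (∑-cong (f≈g ∘ suc))

  ∑-zero : ∀ {k} (f : Fin k → Carrier) → (∀ j → f j ≈ 0#) → ∑ f ≈ 0#
  ∑-zero {zero}  f f≈0 = refl
  ∑-zero {suc k} f f≈0 = trans (+-cong (f≈0 zero) (∑-zero (f ∘ suc) (f≈0 ∘ suc))) (+-identityˡ 0#)

  ∑-single : ∀ {k} (f : Fin k → Carrier) p → (∀ j → j ≢ p → f j ≈ 0#) → ∑ f ≈ f p
  ∑-single {suc k} f zero    f≈0 = trans (+-congˡ (∑-zero (f ∘ suc) (λ j → f≈0 (suc j) λ ()))) (+-identityʳ _)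
  ∑-single {suc k} f (suc p) f≈0 =
    trans (+-cong (f≈0 zero λ ()) (∑-single (f ∘ suc) p (λ j j≢p → f≈0 (suc j) (j≢p ∘ FinP.suc-injective))))
          (+-identityˡ _)

  ∑-pair : ∀ {k} (f : Fin k → Carrier) p q → p ≢ q → (∀ j → j ≢ p → j ≢ q → f j ≈ 0#) → ∑ f ≈ f p + f q
  ∑-pair {suc k} f zero    zero    p≢q f≈0 = ⊥-elim (p≢q ≡.refl)
  ∑-pair {suc k} f zero    (suc q) p≢q f≈0 =
    +-congˡ (∑-single (f ∘ suc) q (λ j j≢q → f≈0 (suc j) (λ ()) (j≢q ∘ FinP.suc-injective)))
  ∑-pair {suc k} f (suc p) zero    p≢q f≈0 =
    trans (+-congˡ (∑-single (f ∘ suc) p (λ j j≢p → f≈0 (suc j) (j≢p ∘ FinP.suc-injective) (λ ())))) (+-comm _ _)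
  ∑-pair {suc k} f (suc p) (suc q) p≢q f≈0 =
    trans (+-cong (f≈0 zero (λ ()) (λ ()))
                  (∑-pair (f ∘ suc) p q (p≢q ∘ ≡.cong suc)
                          (λ j j≢p j≢q → f≈0 (suc j) (j≢p ∘ FinP.suc-injective) (j≢q ∘ FinP.suc-injective))))
          (+-identityˡ _)

  ∑-distrib-+ : ∀ {k} (f g : Fin k → Carrier) → ∑ (λ j → f j + g j) ≈ ∑ f + ∑ g
  ∑-distrib-+ {zero}  f g = sym (+-identityˡ 0#)
  ∑-distrib-+ {suc k} f g = trans (+-congˡ (∑-distrib-+ (f ∘ suc) (g ∘ suc))) (interchange _ _ _ _)

  *-distribˡ-∑ : ∀ {k} x (f : Fin k → Carrier) → x * ∑ f ≈ ∑ (λ j → x * f j)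
  *-distribˡ-∑ {zero}  x f = zeroʳ x
  *-distribˡ-∑ {suc k} x f = trans (distribˡ x _ _) (+-congˡ (*-distribˡ-∑ x (f ∘ suc)))

  *-distribʳ-∑ : ∀ {k} x (f : Fin k → Carrier) → ∑ f * x ≈ ∑ (λ j → f j * x)
  *-distribʳ-∑ {zero}  x f = zeroˡ x
  *-distribʳ-∑ {suc k} x f = trans (distribʳ x _ _) (+-congˡ (*-distribʳ-∑ x (f ∘ suc)))

  ∑-comm : ∀ {k l} (f : Fin k → Fin l → Carrier) → ∑ (λ a → ∑ (λ b → f a b)) ≈ ∑ (λ b → ∑ (λ a → f a b))
  ∑-comm {zero}  {l} f = sym (∑-zero {l} (λ _ → 0#) (λ _ → refl))
  ∑-comm {suc k}     f = trans (+-congˡ (∑-comm (f ∘ suc))) (sym (∑-distrib-+ (f zero) (λ b → ∑ (λ a → f (suc a) b))))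

  combination≈0 : ∀ {a b x y} → x ≈ 0# → y ≈ 0# → a * x + b * y ≈ 0#
  combination≈0 {a} {b} x≈0 y≈0 = trans (+-cong (trans (*-congˡ x≈0) (zeroʳ a)) (trans (*-congˡ y≈0) (zeroʳ b))) (+-identityˡ 0#)

  combination≈0′ : ∀ {a b x y} → x ≈ 0# → y ≈ 0# → x * a + y * b ≈ 0#
  combination≈0′ {a} {b} x≈0 y≈0 = trans (+-cong (trans (*-congʳ x≈0) (zeroˡ a)) (trans (*-congʳ y≈0) (zeroˡ b))) (+-identityˡ 0#)

  δ-diagonal : ∀ i → δ i i ≈ 1#
  δ-diagonal i with i ≟ i
  ... | yes _  = refl
  ... | no i≢i = ⊥-elim (i≢i ≡.refl)

  δ-offDiagonal : ∀ {i j} → i ≢ j → δ i j ≈ 0#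
  δ-offDiagonal {i} {j} i≢j with i ≟ j
  ... | yes i≡j = ⊥-elim (i≢j i≡j)
  ... | no _    = refl

  δ-sym : ∀ i j → δ i j ≈ δ j i
  δ-sym i j with i ≟ j | j ≟ i
  ... | yes _   | yes _   = refl
  ... | no _    | no _    = refl
  ... | yes i≡j | no j≢i  = ⊥-elim (j≢i (≡.sym i≡j))
  ... | no i≢j  | yes j≡i = ⊥-elim (i≢j (≡.sym j≡i))

  -- Record versions of _≈M_, Invertible, InB, InB⁻, _~_ and InCell from Defs: the originals
  -- unfold to function and Σ-types from which Agda cannot infer the matrices involved.
  infix 4 _≋_
  record _≋_ (A B : Mat) : Set ℓ where
    constructor ⟪_⟫
    field entry : A ≈M B
  open _≋_ public

  ≋-refl : ∀ {A} → A ≋ A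
  ≋-refl = ⟪ (λ i j → refl) ⟫

  ≋-sym : ∀ {A B} → A ≋ B → B ≋ A
  ≋-sym A≋B = ⟪ (λ i j → sym (entry A≋B i j)) ⟫

  ≋-trans : ∀ {A B C} → A ≋ B → B ≋ C → A ≋ C
  ≋-trans A≋B B≋C = ⟪ (λ i j → trans (entry A≋B i j) (entry B≋C i j)) ⟫

  ≋-setoid : Setoid c ℓ
  ≋-setoid = record { Carrier = Mat ; _≈_ = _≋_
                    ; isEquivalence = record { refl = ≋-refl ; sym = ≋-sym ; trans = ≋-trans } }

  module ≋-Reasoning = SetoidReasoning ≋-setoid

  ·-cong : ∀ {A A′ B B′} → A ≋ A′ → B ≋ B′ → A · B ≋ A′ · B′
  ·-cong A≋A′ B≋B′ = ⟪ (λ i j → ∑-cong (λ k → *-cong (entry A≋A′ i k) (entry B≋B′ k j))) ⟫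

  ·-congˡ : ∀ A {B B′} → B ≋ B′ → A · B ≋ A · B′
  ·-congˡ A = ·-cong (≋-refl {A})

  ·-congʳ : ∀ B {A A′} → A ≋ A′ → A · B ≋ A′ · B
  ·-congʳ B A≋A′ = ·-cong A≋A′ (≋-refl {B})

  ·-assoc : ∀ A B C → (A · B) · C ≋ A · (B · C)
  ·-assoc A B C = ⟪ (λ i j → begin
    ∑ (λ k → ∑ (λ l → A i l * B l k) * C k j)  ≈⟨ ∑-cong (λ k → *-distribʳ-∑ (C k j) (λ l → A i l * B l k)) ⟩
    ∑ (λ k → ∑ (λ l → A i l * B l k * C k j))  ≈⟨ ∑-comm (λ k l → A i l * B l k * C k j) ⟩
    ∑ (λ l → ∑ (λ k → A i l * B l k * C k j))  ≈⟨ ∑-cong (λ l → ∑-cong (λ k → *-assoc (A i l) (B l k) (C k j))) ⟩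
    ∑ (λ l → ∑ (λ k → A i l * (B l k * C k j))) ≈⟨ ∑-cong (λ l → *-distribˡ-∑ (A i l) (λ k → B l k * C k j)) ⟨
    ∑ (λ l → A i l * ∑ (λ k → B l k * C k j))  ∎) ⟫

  ·-identityˡ : ∀ A → I · A ≋ A
  ·-identityˡ A = ⟪ (λ i j →
    trans (∑-single (λ k → δ i k * A k j) i (λ k k≢i → trans (*-congʳ (δ-offDiagonal (k≢i ∘ ≡.sym))) (zeroˡ _)))
          (trans (*-congʳ (δ-diagonal i)) (*-identityˡ _))) ⟫

  ·-identityʳ : ∀ A → A · I ≋ A
  ·-identityʳ A = ⟪ (λ i j →
    trans (∑-single (λ k → A i k * δ k j) j (λ k k≢j → trans (*-congˡ (δ-offDiagonal k≢j)) (zeroʳ _)))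
          (trans (*-congˡ (δ-diagonal j)) (*-identityʳ _))) ⟫

  ·-cancelʳ : ∀ A B C → B · C ≋ I → (A · B) · C ≋ A
  ·-cancelʳ A B C B·C≋I = ≋-trans (·-assoc A B C) (≋-trans (·-congˡ A B·C≋I) (·-identityʳ A))

  ·-cancelˡ : ∀ A B C → A · B ≋ I → A · (B · C) ≋ C
  ·-cancelˡ A B C A·B≋I = ≋-trans (≋-sym (·-assoc A B C)) (≋-trans (·-congʳ C A·B≋I) (·-identityˡ C))

  record Inv (A : Mat) : Set (c ⊔ ℓ) where
    constructor mkInv
    field
      inv      : Mat
      inverseʳ : A · inv ≋ I
      inverseˡ : inv · A ≋ I
  open Inv public

  Inv-I : Inv I
  Inv-I = mkInv I (·-identityˡ I) (·-identityˡ I)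

  Inv-· : ∀ {A B} → Inv A → Inv B → Inv (A · B)
  Inv-· {A} {B} (mkInv A⁻¹ A·A⁻¹ A⁻¹·A) (mkInv B⁻¹ B·B⁻¹ B⁻¹·B) = mkInv (B⁻¹ · A⁻¹)
    (≋-trans (≋-sym (·-assoc (A · B) B⁻¹ A⁻¹)) (≋-trans (·-congʳ A⁻¹ (·-cancelʳ A B B⁻¹ B·B⁻¹)) A·A⁻¹))
    (≋-trans (≋-sym (·-assoc (B⁻¹ · A⁻¹) A B)) (≋-trans (·-congʳ B (·-cancelʳ B⁻¹ A⁻¹ A A⁻¹·A)) B⁻¹·B))

  Inv-resp-≋ : ∀ {A A′} → A ≋ A′ → Inv A → Inv A′
  Inv-resp-≋ A≋A′ (mkInv A⁻¹ A·A⁻¹ A⁻¹·A) =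
    mkInv A⁻¹ (≋-trans (·-congʳ A⁻¹ (≋-sym A≋A′)) A·A⁻¹) (≋-trans (·-congˡ A⁻¹ (≋-sym A≋A′)) A⁻¹·A)

  UpperTriangular-I : UpperTriangular I
  UpperTriangular-I i j j<i = δ-offDiagonal (FinP.<⇒≢ j<i ∘ ≡.sym)

  UpperTriangular-· : ∀ {A B} → UpperTriangular A → UpperTriangular B → UpperTriangular (A · B)
  UpperTriangular-· {A} {B} A-upper B-upper i j j<i = ∑-zero (λ k → A i k * B k j) vanishes
    where
    vanishes : ∀ k → A i k * B k j ≈ 0#
    vanishes k with k Fin.<? i
    ... | yes k<i = trans (*-congʳ (A-upper i k k<i)) (zeroˡ _)
    ... | no  k≮i = trans (*-congˡ (B-upper k j (ℕP.<-≤-trans j<i (ℕP.≮⇒≥ k≮i)))) (zeroʳ _)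

  LowerTriangular-· : ∀ {A B} → LowerTriangular A → LowerTriangular B → LowerTriangular (A · B)
  LowerTriangular-· {A} {B} A-lower B-lower i j i<j = ∑-zero (λ k → A i k * B k j) vanishes
    where
    vanishes : ∀ k → A i k * B k j ≈ 0#
    vanishes k with i Fin.<? k
    ... | yes i<k = trans (*-congʳ (A-lower i k i<k)) (zeroˡ _)
    ... | no  i≮k = trans (*-congˡ (B-lower k j (ℕP.≤-<-trans (ℕP.≮⇒≥ i≮k) i<j))) (zeroʳ _)

  -- Column j of V vanishes below the diagonal once the columns before it do, by reading
  -- off the entries (i , j) and (j , j) of V · U = I.
  module LeftInverseOfUpper (U V : Mat) (U-upper : UpperTriangular U) (V·U≈I : (V · U) ≈M I) where
    ColumnUpper : Fin n → Set ℓ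
    ColumnUpper j = ∀ i → j < i → V i j ≈ 0#

    V·U-entry : ∀ i j → toℕ j ℕ.≤ toℕ i → (∀ k → k < j → ColumnUpper k) → V i j * U j j ≈ δ i j
    V·U-entry i j j≤i earlier = trans (sym (∑-single (λ k → V i k * U k j) j vanishes)) (V·U≈I i j)
      where
      vanishes : ∀ k → k ≢ j → V i k * U k j ≈ 0#
      vanishes k k≢j with k Fin.<? j
      ... | yes k<j = trans (*-congʳ (earlier k k<j i (ℕP.<-≤-trans k<j j≤i))) (zeroˡ _)
      ... | no  k≮j = trans (*-congˡ (U-upper k j (ℕP.≤∧≢⇒< (ℕP.≮⇒≥ k≮j) (k≢j ∘ ≡.sym ∘ FinP.toℕ-injective))))
                            (zeroʳ _)

    columnUpper-step : ∀ j → (∀ k → k < j → ColumnUpper k) → ColumnUpper j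
    columnUpper-step j earlier i j<i = begin
      V i j                    ≈⟨ *-identityʳ _ ⟨
      V i j * 1#               ≈⟨ *-congˡ (trans (V·U-entry j j ℕP.≤-refl earlier) (δ-diagonal j)) ⟨
      V i j * (V j j * U j j)  ≈⟨ x∙yz≈xz∙y (V i j) (V j j) (U j j) ⟩
      (V i j * U j j) * V j j  ≈⟨ *-congʳ (trans (V·U-entry i j (ℕP.<⇒≤ j<i) earlier) (δ-offDiagonal (FinP.<⇒≢ j<i ∘ ≡.sym))) ⟩
      0# * V j j               ≈⟨ zeroˡ _ ⟩
      0#                       ∎

    columnUpper : ∀ j → ColumnUpper j
    columnUpper j = below (suc (toℕ j)) j ℕP.≤-refl
      where
      below : ∀ b j → toℕ j ℕ.< b → ColumnUpper j
      below (suc b) j j<1+b = columnUpper-step j (λ k k<j → below b k (ℕP.<-≤-trans k<j (ℕP.≤-pred j<1+b)))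

    upper : UpperTriangular V
    upper i j j<i = columnUpper j i j<i

    diagonal : ∀ j → V j j * U j j ≈ 1#
    diagonal j = trans (V·U-entry j j ℕP.≤-refl (λ k _ → columnUpper k)) (δ-diagonal j)

  x*y≈1⇒y≉0 : ∀ {x y} → x * y ≈ 1# → ¬ (y ≈ 0#)
  x*y≈1⇒y≉0 {x} x*y≈1 y≈0 = 1≉0 (trans (sym x*y≈1) (trans (*-congˡ y≈0) (zeroʳ x)))

  record IsB (b : Mat) : Set (c ⊔ ℓ) where
    constructor mkB
    field
      invB   : Inv b
      upperB : UpperTriangular b
  open IsB public

  record IsB⁻ (b : Mat) : Set (c ⊔ ℓ) where
    constructor mkB⁻
    field
      invB⁻   : Inv b
      lowerB⁻ : LowerTriangular b
  open IsB⁻ public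

  IsB-I : IsB I
  IsB-I = mkB Inv-I UpperTriangular-I

  IsB-· : ∀ {A B} → IsB A → IsB B → IsB (A · B)
  IsB-· (mkB A-inv A-upper) (mkB B-inv B-upper) = mkB (Inv-· A-inv B-inv) (UpperTriangular-· A-upper B-upper)

  IsB⁻-· : ∀ {A B} → IsB⁻ A → IsB⁻ B → IsB⁻ (A · B)
  IsB⁻-· (mkB⁻ A-inv A-lower) (mkB⁻ B-inv B-lower) = mkB⁻ (Inv-· A-inv B-inv) (LowerTriangular-· A-lower B-lower)

  IsB-inverse : ∀ {b} (b∈B : IsB b) → IsB (inv (invB b∈B))
  IsB-inverse {b} (mkB (mkInv b⁻¹ b·b⁻¹ b⁻¹·b) b-upper) =
    mkB (mkInv b b⁻¹·b b·b⁻¹) (LeftInverseOfUpper.upper b b⁻¹ b-upper (entry b⁻¹·b))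

  IsB-diagonal≉0 : ∀ {b} → IsB b → ∀ j → ¬ (b j j ≈ 0#)
  IsB-diagonal≉0 {b} (mkB (mkInv b⁻¹ _ b⁻¹·b) b-upper) j =
    x*y≈1⇒y≉0 (LeftInverseOfUpper.diagonal b b⁻¹ b-upper (entry b⁻¹·b) j)

  -- The transpose of b · b⁻¹ = I exhibits (b⁻¹)ᵀ as a left inverse of the upper triangular bᵀ.
  IsB⁻-inverse : ∀ {b} (b∈B⁻ : IsB⁻ b) → IsB⁻ (inv (invB⁻ b∈B⁻))
  IsB⁻-inverse {b} (mkB⁻ (mkInv b⁻¹ b·b⁻¹ b⁻¹·b) b-lower) = mkB⁻ (mkInv b b⁻¹·b b·b⁻¹)
    (λ i j i<j → LeftInverseOfUpper.upper (λ r k → b k r) (λ r k → b⁻¹ k r) (λ k j k<j → b-lower j k k<j)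
      (λ r k → trans (∑-cong (λ l → *-comm (b⁻¹ l r) (b k l))) (trans (entry b·b⁻¹ k r) (δ-sym k r))) j i i<j)

module Cosets {c ℓ : Level} (F : FiniteField c ℓ) (m : ℕ) where
  open FiniteField F hiding (zero)
  open Hecke F m
  open Matrices F m

  infix 4 _∼_
  record _∼_ (g g′ : Mat) : Set (c ⊔ ℓ) where
    constructor mk∼
    field
      {witness} : Mat
      witness∈B    : IsB witness
      g′≋g·witness : g′ ≋ g · witness

  ∼-refl : ∀ {g} → g ∼ g
  ∼-refl {g} = mk∼ IsB-I (≋-sym (·-identityʳ g))

  ≋⇒∼ : ∀ {g g′} → g ≋ g′ → g ∼ g′
  ≋⇒∼ {g} g≋g′ = mk∼ IsB-I (≋-trans (≋-sym g≋g′) (≋-sym (·-identityʳ g)))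

  ∼-trans : ∀ {g g′ g″} → g ∼ g′ → g′ ∼ g″ → g ∼ g″
  ∼-trans {g} (mk∼ {b} b∈B g′≋g·b) (mk∼ {b′} b′∈B g″≋g′·b′) =
    mk∼ (IsB-· b∈B b′∈B) (≋-trans g″≋g′·b′ (≋-trans (·-congʳ b′ g′≋g·b) (·-assoc g b b′)))

  ∼-sym : ∀ {g g′} → g ∼ g′ → g′ ∼ g
  ∼-sym {g} (mk∼ {b} b∈B g′≋g·b) = mk∼ (IsB-inverse b∈B)
    (≋-sym (≋-trans (·-congʳ b⁻¹ g′≋g·b) (·-cancelʳ g b b⁻¹ (inverseʳ (invB b∈B)))))
    where b⁻¹ = inv (invB b∈B)

  ∼-setoid : Setoid c (c ⊔ ℓ)
  ∼-setoid = record { Carrier = Mat ; _≈_ = _∼_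
                    ; isEquivalence = record { refl = ∼-refl ; sym = ∼-sym ; trans = ∼-trans } }

  ·-congˡ-∼ : ∀ g {x y} → x ∼ y → g · x ∼ g · y
  ·-congˡ-∼ g {x} (mk∼ {b} b∈B y≋x·b) = mk∼ b∈B (≋-trans (·-congˡ g y≋x·b) (≋-sym (·-assoc g x b)))

  ∼-resp-≋ : ∀ {x x′ y y′} → x ≋ x′ → y ≋ y′ → x ∼ y → x′ ∼ y′
  ∼-resp-≋ x≋x′ y≋y′ x∼y = ∼-trans (≋⇒∼ (≋-sym x≋x′)) (∼-trans x∼y (≋⇒∼ y≋y′))

  Inv-resp-∼ : ∀ {g g′} → Inv g → g ∼ g′ → Inv g′
  Inv-resp-∼ g-inv (mk∼ b∈B g′≋g·b) = Inv-resp-≋ (≋-sym g′≋g·b) (Inv-· g-inv (invB b∈B))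

  ∼⇒~ : ∀ {g g′} → g ∼ g′ → g ~ g′
  ∼⇒~ (mk∼ (mkB (mkInv b⁻¹ b·b⁻¹ b⁻¹·b) b-upper) g′≋g·b) =
    _ , ((b⁻¹ , entry b·b⁻¹ , entry b⁻¹·b) , b-upper) , entry g′≋g·b

  ~⇒∼ : ∀ {g g′} → g ~ g′ → g ∼ g′
  ~⇒∼ (b , ((b⁻¹ , b·b⁻¹ , b⁻¹·b) , b-upper) , g′≈g·b) = mk∼ (mkB (mkInv b⁻¹ ⟪ b·b⁻¹ ⟫ ⟪ b⁻¹·b ⟫) b-upper) ⟪ g′≈g·b ⟫

  ·P-entry : ∀ A (σ : Permutation′ n) r j → (A · P σ) r j ≈ A r (σ ⟨$⟩ʳ j)
  ·P-entry A σ r j =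
    trans (∑-single (λ k → A r k * δ k (σ ⟨$⟩ʳ j)) (σ ⟨$⟩ʳ j) (λ k k≢σj → trans (*-congˡ (δ-offDiagonal k≢σj)) (zeroʳ _)))
          (trans (*-congˡ (δ-diagonal (σ ⟨$⟩ʳ j))) (*-identityʳ _))

  P·-entry : ∀ (σ : Permutation′ n) A r j → (P σ · A) r j ≈ A (σ ⟨$⟩ˡ r) j
  P·-entry σ A r j =
    trans (∑-single (λ k → δ r (σ ⟨$⟩ʳ k) * A k j) (σ ⟨$⟩ˡ r) (λ k k≢σ⁻¹r → trans (*-congʳ (δ-offDiagonal (r≢σk k≢σ⁻¹r))) (zeroˡ _)))
          (trans (*-congʳ (trans (reflexive (≡.cong (δ r) (Perm.inverseʳ σ))) (δ-diagonal r))) (*-identityˡ _))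
    where
    r≢σk : ∀ {k} → k ≢ σ ⟨$⟩ˡ r → r ≢ σ ⟨$⟩ʳ k
    r≢σk k≢σ⁻¹r r≡σk = k≢σ⁻¹r (≡.trans (≡.sym (Perm.inverseˡ σ)) (≡.cong (σ ⟨$⟩ˡ_) (≡.sym r≡σk)))

  P·-entry-σ : ∀ (σ : Permutation′ n) A k j → (P σ · A) (σ ⟨$⟩ʳ k) j ≈ A k j
  P·-entry-σ σ A k j = trans (P·-entry σ A (σ ⟨$⟩ʳ k) j) (reflexive (≡.cong (λ z → A z j) (Perm.inverseˡ σ)))

  P-∘ₚ : ∀ (σ τ : Permutation′ n) → P σ · P τ ≋ P (τ ∘ₚ σ)
  P-∘ₚ σ τ = ⟪ (λ r j → ·P-entry (P σ) τ r j) ⟫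

  P-cong : ∀ {σ τ : Permutation′ n} → (∀ j → σ ⟨$⟩ʳ j ≡ τ ⟨$⟩ʳ j) → P σ ≋ P τ
  P-cong σ≗τ = ⟪ (λ r j → reflexive (≡.cong (δ r) (σ≗τ j))) ⟫

  Inv-P : ∀ σ → Inv (P σ)
  Inv-P σ = mkInv (P (Perm.flip σ))
    ⟪ (λ r j → trans (·P-entry (P σ) (Perm.flip σ) r j) (reflexive (≡.cong (δ r) (Perm.inverseʳ σ)))) ⟫
    ⟪ (λ r j → trans (·P-entry (P (Perm.flip σ)) σ r j) (reflexive (≡.cong (δ r) (Perm.inverseˡ σ)))) ⟫

  conjugate : Permutation′ n → Mat → Mat
  conjugate σ A = (P σ · A) · P (Perm.flip σ)

  conjugate-entry : ∀ σ A r k → conjugate σ A r k ≈ A (σ ⟨$⟩ˡ r) (σ ⟨$⟩ˡ k)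
  conjugate-entry σ A r k = trans (·P-entry (P σ · A) (Perm.flip σ) r k) (P·-entry σ A r (σ ⟨$⟩ˡ k))

  P·≋conjugate·P : ∀ σ A → P σ · A ≋ conjugate σ A · P σ
  P·≋conjugate·P σ A = ≋-sym (·-cancelʳ (P σ · A) (P (Perm.flip σ)) (P σ) (inverseˡ (Inv-P σ)))

  Inv-conjugate : ∀ σ {A} → Inv A → Inv (conjugate σ A)
  Inv-conjugate σ A-inv = Inv-· (Inv-· (Inv-P σ) A-inv) (Inv-P (Perm.flip σ))

  record Cell (σ : Permutation′ n) (g : Mat) : Set (c ⊔ ℓ) where
    constructor mkCell
    field
      {lowerPart upperPart} : Mat
      lowerPart∈B⁻ : IsB⁻ lowerPart
      upperPart∈B  : IsB upperPart
      decomposition : g ≋ (lowerPart · P σ) · upperPart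
  open Cell public

  Cell⇒InCell : ∀ {σ g} → Cell σ g → InCell σ g
  Cell⇒InCell (mkCell {L} {U} (mkB⁻ (mkInv L⁻¹ L·L⁻¹ L⁻¹·L) L-lower) (mkB (mkInv U⁻¹ U·U⁻¹ U⁻¹·U) U-upper) g≋LPU) =
    L , U , ((L⁻¹ , entry L·L⁻¹ , entry L⁻¹·L) , L-lower) , ((U⁻¹ , entry U·U⁻¹ , entry U⁻¹·U) , U-upper) , entry g≋LPU

  InCell⇒Cell : ∀ {σ g} → InCell σ g → Cell σ g
  InCell⇒Cell (L , U , ((L⁻¹ , L·L⁻¹ , L⁻¹·L) , L-lower) , ((U⁻¹ , U·U⁻¹ , U⁻¹·U) , U-upper) , g≈LPU) =
    mkCell (mkB⁻ (mkInv L⁻¹ ⟪ L·L⁻¹ ⟫ ⟪ L⁻¹·L ⟫) L-lower) (mkB (mkInv U⁻¹ ⟪ U·U⁻¹ ⟫ ⟪ U⁻¹·U ⟫) U-upper) ⟪ g≈LPU ⟫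

  Cell-resp-∼ : ∀ {σ g g′} → Cell σ g → g ∼ g′ → Cell σ g′
  Cell-resp-∼ {σ} (mkCell {L} {U} L∈B⁻ U∈B g≋LPU) (mk∼ {b} b∈B g′≋g·b) =
    mkCell L∈B⁻ (IsB-· U∈B b∈B) (≋-trans g′≋g·b (≋-trans (·-congʳ b g≋LPU) (·-assoc (L · P σ) U b)))

  Cell-cong : ∀ {σ τ g} → (∀ j → σ ⟨$⟩ʳ j ≡ τ ⟨$⟩ʳ j) → Cell σ g → Cell τ g
  Cell-cong {σ} {τ} σ≗τ (mkCell {L} {U} L∈B⁻ U∈B g≋LPU) =
    mkCell L∈B⁻ U∈B (≋-trans g≋LPU (·-congʳ U (·-congˡ L (P-cong {σ} {τ} σ≗τ))))

  Cell⇒Inv : ∀ {σ g} → Cell σ g → Inv g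
  Cell⇒Inv {σ} (mkCell L∈B⁻ U∈B g≋LPU) = Inv-resp-≋ (≋-sym g≋LPU) (Inv-· (Inv-· (invB⁻ L∈B⁻) (Inv-P σ)) (invB U∈B))

  Cell-b⁻P : ∀ {σ L} → IsB⁻ L → Cell σ (L · P σ)
  Cell-b⁻P {σ} {L} L∈B⁻ = mkCell L∈B⁻ IsB-I (≋-sym (·-identityʳ (L · P σ)))

module Block {c ℓ : Level} (F : FiniteField c ℓ) (m : ℕ) (i : Fin m) where
  open FiniteField F hiding (zero)
  open Hecke F m
  open Matrices F m

  i₁ i₂ : Fin n
  i₁ = inject₁ i
  i₂ = suc i

  i₁<i₂ : i₁ < i₂
  i₁<i₂ = ℕP.≤-reflexive (≡.cong suc (FinP.toℕ-inject₁ i))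

  i₁≢i₂ : i₁ ≢ i₂
  i₁≢i₂ = FinP.<⇒≢ i₁<i₂

  i₂≢i₁ : i₂ ≢ i₁
  i₂≢i₁ = i₁≢i₂ ∘ ≡.sym

  <i₂⇒≤i₁ : ∀ {k : Fin n} → k < i₂ → toℕ k ℕ.≤ toℕ i₁
  <i₂⇒≤i₁ k<i₂ = ℕP.≤-trans (ℕP.≤-pred k<i₂) (ℕP.≤-reflexive (≡.sym (FinP.toℕ-inject₁ i)))

  <i₂⇒<i₁ : ∀ {k : Fin n} → k ≢ i₁ → k < i₂ → k < i₁
  <i₂⇒<i₁ k≢i₁ k<i₂ = ℕP.≤∧≢⇒< (<i₂⇒≤i₁ k<i₂) (k≢i₁ ∘ FinP.toℕ-injective)

  i₁<⇒i₂< : ∀ {r : Fin n} → r ≢ i₂ → i₁ < r → i₂ < r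
  i₁<⇒i₂< r≢i₂ i₁<r = ℕP.≤∧≢⇒< (ℕP.≤-trans (ℕP.≤-reflexive (≡.cong suc (≡.sym (FinP.toℕ-inject₁ i)))) i₁<r)
                                   (r≢i₂ ∘ ≡.sym ∘ FinP.toℕ-injective)

  data Pos (r : Fin n) : Set where
    at₁ : r ≡ i₁ → Pos r
    at₂ : r ≡ i₂ → Pos r
    off : r ≢ i₁ → r ≢ i₂ → Pos r

  pos : ∀ r → Pos r
  pos r with r ≟ i₁ | r ≟ i₂
  ... | yes r≡i₁ | _        = at₁ r≡i₁
  ... | no _     | yes r≡i₂ = at₂ r≡i₂
  ... | no r≢i₁  | no r≢i₂  = off r≢i₁ r≢i₂

  transpose-i₁ : PC.transpose i₁ i₂ i₁ ≡ i₂
  transpose-i₁ with i₁ ≟ i₁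
  ... | yes _  = ≡.refl
  ... | no i≢i = ⊥-elim (i≢i ≡.refl)

  transpose-i₂ : PC.transpose i₁ i₂ i₂ ≡ i₁
  transpose-i₂ with i₂ ≟ i₁
  ... | yes i₂≡i₁ = ⊥-elim (i₂≢i₁ i₂≡i₁)
  ... | no _ with i ≟ i
  ...   | yes _  = ≡.refl
  ...   | no i≢i = ⊥-elim (i≢i ≡.refl)

  transpose-off : ∀ {k} → k ≢ i₁ → k ≢ i₂ → PC.transpose i₁ i₂ k ≡ k
  transpose-off {k} k≢i₁ k≢i₂ with k ≟ i₁
  ... | yes k≡i₁ = ⊥-elim (k≢i₁ k≡i₁)
  ... | no _ with k ≟ i₂
  ...   | yes k≡i₂ = ⊥-elim (k≢i₂ k≡i₂)
  ...   | no _     = ≡.refl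

  transpose-involutive : ∀ k → PC.transpose i₁ i₂ (PC.transpose i₁ i₂ k) ≡ k
  transpose-involutive k with pos k
  ... | at₁ ≡.refl        = ≡.trans (≡.cong (PC.transpose i₁ i₂) transpose-i₁) transpose-i₂
  ... | at₂ ≡.refl        = ≡.trans (≡.cong (PC.transpose i₁ i₂) transpose-i₂) transpose-i₁
  ... | off k≢i₁ k≢i₂ = ≡.trans (≡.cong (PC.transpose i₁ i₂) (transpose-off k≢i₁ k≢i₂)) (transpose-off k≢i₁ k≢i₂)

  record M₂ : Set c where
    constructor m₂
    field e₁₁ e₁₂ e₂₁ e₂₂ : Carrier
  open M₂ public

  infixl 7 _⊙_
  _⊙_ : M₂ → M₂ → M₂
  M ⊙ N = m₂ (e₁₁ M * e₁₁ N + e₁₂ M * e₂₁ N) (e₁₁ M * e₁₂ N + e₁₂ M * e₂₂ N)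
             (e₂₁ M * e₁₁ N + e₂₂ M * e₂₁ N) (e₂₁ M * e₁₂ N + e₂₂ M * e₂₂ N)

  infix 4 _≈₂_
  record _≈₂_ (M N : M₂) : Set ℓ where
    constructor ≈₂⟨_,_,_,_⟩
    field
      ≈₁₁ : e₁₁ M ≈ e₁₁ N
      ≈₁₂ : e₁₂ M ≈ e₁₂ N
      ≈₂₁ : e₂₁ M ≈ e₂₁ N
      ≈₂₂ : e₂₂ M ≈ e₂₂ N
  open _≈₂_ public

  ≈₂-trans : ∀ {M N K} → M ≈₂ N → N ≈₂ K → M ≈₂ K
  ≈₂-trans M≈N N≈K = ≈₂⟨ trans (≈₁₁ M≈N) (≈₁₁ N≈K) , trans (≈₁₂ M≈N) (≈₁₂ N≈K)
                       , trans (≈₂₁ M≈N) (≈₂₁ N≈K) , trans (≈₂₂ M≈N) (≈₂₂ N≈K) ⟩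

  I₂ : M₂
  I₂ = m₂ 1# 0# 0# 1#

  data Slot : Set where
    first second outside : Slot

  slot : ∀ {r} → Pos r → Slot
  slot (at₁ _)   = first
  slot (at₂ _)   = second
  slot (off _ _) = outside

  slot-unique : ∀ {r} (p p′ : Pos r) → slot p ≡ slot p′
  slot-unique (at₁ _)       (at₁ _)       = ≡.refl
  slot-unique (at₂ _)       (at₂ _)       = ≡.refl
  slot-unique (off _ _)     (off _ _)     = ≡.refl
  slot-unique (at₁ r≡i₁)    (at₂ r≡i₂)    = ⊥-elim (i₁≢i₂ (≡.trans (≡.sym r≡i₁) r≡i₂))
  slot-unique (at₂ r≡i₂)    (at₁ r≡i₁)    = ⊥-elim (i₁≢i₂ (≡.trans (≡.sym r≡i₁) r≡i₂))
  slot-unique (at₁ r≡i₁)    (off r≢i₁ _)  = ⊥-elim (r≢i₁ r≡i₁)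
  slot-unique (off r≢i₁ _)  (at₁ r≡i₁)    = ⊥-elim (r≢i₁ r≡i₁)
  slot-unique (at₂ r≡i₂)    (off _ r≢i₂)  = ⊥-elim (r≢i₂ r≡i₂)
  slot-unique (off _ r≢i₂)  (at₂ r≡i₂)    = ⊥-elim (r≢i₂ r≡i₂)

  blockEntry : M₂ → Fin n → Fin n → Slot → Slot → Carrier
  blockEntry M r k first  first  = e₁₁ M
  blockEntry M r k first  second = e₁₂ M
  blockEntry M r k second first  = e₂₁ M
  blockEntry M r k second second = e₂₂ M
  blockEntry M r k _      _      = δ r k

  blockEntry-outsideʳ : ∀ M r k slotʳ → blockEntry M r k slotʳ outside ≡ δ r k
  blockEntry-outsideʳ M r k first   = ≡.refl
  blockEntry-outsideʳ M r k second  = ≡.refl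
  blockEntry-outsideʳ M r k outside = ≡.refl

  -- The identity matrix with the 2 × 2 block in rows and columns i₁ , i₂ replaced by M.
  E : M₂ → Mat
  E M r k = blockEntry M r k (slot (pos r)) (slot (pos k))

  E-entry : ∀ M {r k} (pr : Pos r) (pk : Pos k) → E M r k ≈ blockEntry M r k (slot pr) (slot pk)
  E-entry M {r} {k} pr pk = reflexive (≡.cong₂ (blockEntry M r k) (slot-unique (pos r) pr) (slot-unique (pos k) pk))

  E-at : ∀ M {r k} (pr : Pos r) (pk : Pos k) → blockEntry M r k (slot pr) (slot pk) ≈ E M r k
  E-at M pr pk = sym (E-entry M pr pk)

  E-offColumn : ∀ M r {k} → k ≢ i₁ → k ≢ i₂ → E M r k ≈ δ r k
  E-offColumn M r {k} k≢i₁ k≢i₂ = trans (E-entry M (pos r) (off k≢i₁ k≢i₂)) (reflexive (blockEntry-outsideʳ M r k (slot (pos r))))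

  E-offRow : ∀ M {r} k → r ≢ i₁ → r ≢ i₂ → E M r k ≈ δ r k
  E-offRow M {r} k r≢i₁ r≢i₂ = E-entry M (off r≢i₁ r≢i₂) (pos k)

  ·E-column₁ : ∀ A M r → (A · E M) r i₁ ≈ A r i₁ * e₁₁ M + A r i₂ * e₂₁ M
  ·E-column₁ A M r =
    trans (∑-pair (λ l → A r l * E M l i₁) i₁ i₂ i₁≢i₂
                  (λ l l≢i₁ l≢i₂ → trans (*-congˡ (trans (E-offRow M i₁ l≢i₁ l≢i₂) (δ-offDiagonal l≢i₁))) (zeroʳ _)))
          (+-cong (*-congˡ (E-entry M (at₁ ≡.refl) (at₁ ≡.refl))) (*-congˡ (E-entry M (at₂ ≡.refl) (at₁ ≡.refl))))

  ·E-column₂ : ∀ A M r → (A · E M) r i₂ ≈ A r i₁ * e₁₂ M + A r i₂ * e₂₂ M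
  ·E-column₂ A M r =
    trans (∑-pair (λ l → A r l * E M l i₂) i₁ i₂ i₁≢i₂
                  (λ l l≢i₁ l≢i₂ → trans (*-congˡ (trans (E-offRow M i₂ l≢i₁ l≢i₂) (δ-offDiagonal l≢i₂))) (zeroʳ _)))
          (+-cong (*-congˡ (E-entry M (at₁ ≡.refl) (at₂ ≡.refl))) (*-congˡ (E-entry M (at₂ ≡.refl) (at₂ ≡.refl))))

  ·E-offColumn : ∀ A M r {k} → k ≢ i₁ → k ≢ i₂ → (A · E M) r k ≈ A r k
  ·E-offColumn A M r {k} k≢i₁ k≢i₂ =
    trans (∑-single (λ l → A r l * E M l k) k
                    (λ l l≢k → trans (*-congˡ (trans (E-offColumn M l k≢i₁ k≢i₂) (δ-offDiagonal l≢k))) (zeroʳ _)))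
          (trans (*-congˡ (trans (E-offColumn M k k≢i₁ k≢i₂) (δ-diagonal k))) (*-identityʳ _))

  E·-row₁ : ∀ M A k → (E M · A) i₁ k ≈ e₁₁ M * A i₁ k + e₁₂ M * A i₂ k
  E·-row₁ M A k =
    trans (∑-pair (λ l → E M i₁ l * A l k) i₁ i₂ i₁≢i₂
                  (λ l l≢i₁ l≢i₂ → trans (*-congʳ (trans (E-offColumn M i₁ l≢i₁ l≢i₂) (δ-offDiagonal (l≢i₁ ∘ ≡.sym)))) (zeroˡ _)))
          (+-cong (*-congʳ (E-entry M (at₁ ≡.refl) (at₁ ≡.refl))) (*-congʳ (E-entry M (at₁ ≡.refl) (at₂ ≡.refl))))

  E·-row₂ : ∀ M A k → (E M · A) i₂ k ≈ e₂₁ M * A i₁ k + e₂₂ M * A i₂ k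
  E·-row₂ M A k =
    trans (∑-pair (λ l → E M i₂ l * A l k) i₁ i₂ i₁≢i₂
                  (λ l l≢i₁ l≢i₂ → trans (*-congʳ (trans (E-offColumn M i₂ l≢i₁ l≢i₂) (δ-offDiagonal (l≢i₂ ∘ ≡.sym)))) (zeroˡ _)))
          (+-cong (*-congʳ (E-entry M (at₂ ≡.refl) (at₁ ≡.refl))) (*-congʳ (E-entry M (at₂ ≡.refl) (at₂ ≡.refl))))

  E·-offRow : ∀ M A {r} k → r ≢ i₁ → r ≢ i₂ → (E M · A) r k ≈ A r k
  E·-offRow M A {r} k r≢i₁ r≢i₂ =
    trans (∑-single (λ l → E M r l * A l k) r
                    (λ l l≢r → trans (*-congʳ (trans (E-offRow M l r≢i₁ r≢i₂) (δ-offDiagonal (l≢r ∘ ≡.sym)))) (zeroˡ _)))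
          (trans (*-congʳ (trans (E-offRow M r r≢i₁ r≢i₂) (δ-diagonal r))) (*-identityˡ _))

  E-⊙ : ∀ M N → E M · E N ≋ E (M ⊙ N)
  E-⊙ M N = ⟪ (λ r k → entries r k (pos r) (pos k)) ⟫
    where
    off-zero : ∀ M {r} k → r ≢ i₁ → r ≢ i₂ → k ≡ i₁ ⊎ k ≡ i₂ → E M r k ≈ 0#
    off-zero M k r≢i₁ r≢i₂ (inj₁ ≡.refl) = trans (E-offRow M k r≢i₁ r≢i₂) (δ-offDiagonal r≢i₁)
    off-zero M k r≢i₁ r≢i₂ (inj₂ ≡.refl) = trans (E-offRow M k r≢i₁ r≢i₂) (δ-offDiagonal r≢i₂)
    off-combination : ∀ {r} → r ≢ i₁ → r ≢ i₂ → ∀ x y → E M r i₁ * x + E M r i₂ * y ≈ 0#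
    off-combination r≢i₁ r≢i₂ x y =
      trans (+-cong (trans (*-congʳ (off-zero M i₁ r≢i₁ r≢i₂ (inj₁ ≡.refl))) (zeroˡ x))
                    (trans (*-congʳ (off-zero M i₂ r≢i₁ r≢i₂ (inj₂ ≡.refl))) (zeroˡ y)))
            (+-identityˡ 0#)
    entries : ∀ r k → Pos r → Pos k → (E M · E N) r k ≈ E (M ⊙ N) r k
    entries r k pr (off k≢i₁ k≢i₂) =
      trans (·E-offColumn (E M) N r k≢i₁ k≢i₂) (trans (E-offColumn M r k≢i₁ k≢i₂) (sym (E-offColumn (M ⊙ N) r k≢i₁ k≢i₂)))
    entries r k (at₁ ≡.refl) (at₁ ≡.refl) = trans (·E-column₁ (E M) N r)
      (trans (+-cong (*-congʳ (E-entry M (at₁ ≡.refl) (at₁ ≡.refl))) (*-congʳ (E-entry M (at₁ ≡.refl) (at₂ ≡.refl))))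
             (E-at (M ⊙ N) (at₁ ≡.refl) (at₁ ≡.refl)))
    entries r k (at₂ ≡.refl) (at₁ ≡.refl) = trans (·E-column₁ (E M) N r)
      (trans (+-cong (*-congʳ (E-entry M (at₂ ≡.refl) (at₁ ≡.refl))) (*-congʳ (E-entry M (at₂ ≡.refl) (at₂ ≡.refl))))
             (E-at (M ⊙ N) (at₂ ≡.refl) (at₁ ≡.refl)))
    entries r k (at₁ ≡.refl) (at₂ ≡.refl) = trans (·E-column₂ (E M) N r)
      (trans (+-cong (*-congʳ (E-entry M (at₁ ≡.refl) (at₁ ≡.refl))) (*-congʳ (E-entry M (at₁ ≡.refl) (at₂ ≡.refl))))
             (E-at (M ⊙ N) (at₁ ≡.refl) (at₂ ≡.refl)))
    entries r k (at₂ ≡.refl) (at₂ ≡.refl) = trans (·E-column₂ (E M) N r)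
      (trans (+-cong (*-congʳ (E-entry M (at₂ ≡.refl) (at₁ ≡.refl))) (*-congʳ (E-entry M (at₂ ≡.refl) (at₂ ≡.refl))))
             (E-at (M ⊙ N) (at₂ ≡.refl) (at₂ ≡.refl)))
    entries r k (off r≢i₁ r≢i₂) (at₁ ≡.refl) = trans (·E-column₁ (E M) N r)
      (trans (off-combination r≢i₁ r≢i₂ _ _) (sym (off-zero (M ⊙ N) k r≢i₁ r≢i₂ (inj₁ ≡.refl))))
    entries r k (off r≢i₁ r≢i₂) (at₂ ≡.refl) = trans (·E-column₂ (E M) N r)
      (trans (off-combination r≢i₁ r≢i₂ _ _) (sym (off-zero (M ⊙ N) k r≢i₁ r≢i₂ (inj₂ ≡.refl))))

  E-cong : ∀ {M N} → M ≈₂ N → E M ≋ E N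
  E-cong {M} {N} M≈N = ⟪ (λ r k → entries r k (slot (pos r)) (slot (pos k))) ⟫
    where
    entries : ∀ r k slotʳ slotᵏ → blockEntry M r k slotʳ slotᵏ ≈ blockEntry N r k slotʳ slotᵏ
    entries r k first   first   = ≈₁₁ M≈N
    entries r k first   second  = ≈₁₂ M≈N
    entries r k second  first   = ≈₂₁ M≈N
    entries r k second  second  = ≈₂₂ M≈N
    entries r k first   outside = refl
    entries r k second  outside = refl
    entries r k outside _       = refl

  blockEntry-I₂ : ∀ {r k} (pr : Pos r) (pk : Pos k) → blockEntry I₂ r k (slot pr) (slot pk) ≈ δ r k
  blockEntry-I₂ (at₁ ≡.refl) (at₁ ≡.refl) = sym (δ-diagonal i₁)
  blockEntry-I₂ (at₁ ≡.refl) (at₂ ≡.refl) = sym (δ-offDiagonal i₁≢i₂)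
  blockEntry-I₂ (at₂ ≡.refl) (at₁ ≡.refl) = sym (δ-offDiagonal i₂≢i₁)
  blockEntry-I₂ (at₂ ≡.refl) (at₂ ≡.refl) = sym (δ-diagonal i₂)
  blockEntry-I₂ (at₁ _)      (off _ _)    = refl
  blockEntry-I₂ (at₂ _)      (off _ _)    = refl
  blockEntry-I₂ (off _ _)    _            = refl

  E-I₂ : E I₂ ≋ I
  E-I₂ = ⟪ (λ r k → blockEntry-I₂ (pos r) (pos k)) ⟫

  record Inv₂ (M : M₂) : Set (c ⊔ ℓ) where
    constructor mkInv₂
    field
      inverse₂  : M₂
      inverse₂ʳ : M ⊙ inverse₂ ≈₂ I₂
      inverse₂ˡ : inverse₂ ⊙ M ≈₂ I₂

  Inv-E : ∀ {M} → Inv₂ M → Inv (E M)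
  Inv-E {M} (mkInv₂ M⁻¹ M⊙M⁻¹ M⁻¹⊙M) =
    mkInv (E M⁻¹) (≋-trans (E-⊙ M M⁻¹) (≋-trans (E-cong M⊙M⁻¹) E-I₂)) (≋-trans (E-⊙ M⁻¹ M) (≋-trans (E-cong M⁻¹⊙M) E-I₂))

  swap₂ : M₂
  swap₂ = m₂ 0# 1# 1# 0#

  lower₂ : Carrier → M₂
  lower₂ t = m₂ 1# 0# t 1#

  sM≋E-swap₂ : sM i ≋ E swap₂
  sM≋E-swap₂ = ⟪ (λ r k → entries (pos r) (pos k)) ⟫
    where
    δ-transpose : ∀ r k {k′} → PC.transpose i₁ i₂ k ≡ k′ → δ r (PC.transpose i₁ i₂ k) ≈ δ r k′
    δ-transpose r k eq = reflexive (≡.cong (δ r) eq)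
    entries : ∀ {r k} (pr : Pos r) (pk : Pos k) → δ r (PC.transpose i₁ i₂ k) ≈ E swap₂ r k
    entries {r} {k} pr (off k≢i₁ k≢i₂) = trans (δ-transpose r k (transpose-off k≢i₁ k≢i₂)) (sym (E-offColumn swap₂ r k≢i₁ k≢i₂))
    entries (at₁ ≡.refl) (at₁ ≡.refl) =
      trans (δ-transpose i₁ i₁ transpose-i₁) (trans (δ-offDiagonal i₁≢i₂) (E-at swap₂ (at₁ ≡.refl) (at₁ ≡.refl)))
    entries (at₁ ≡.refl) (at₂ ≡.refl) =
      trans (δ-transpose i₁ i₂ transpose-i₂) (trans (δ-diagonal i₁) (E-at swap₂ (at₁ ≡.refl) (at₂ ≡.refl)))
    entries (at₂ ≡.refl) (at₁ ≡.refl) =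
      trans (δ-transpose i₂ i₁ transpose-i₁) (trans (δ-diagonal i₂) (E-at swap₂ (at₂ ≡.refl) (at₁ ≡.refl)))
    entries (at₂ ≡.refl) (at₂ ≡.refl) =
      trans (δ-transpose i₂ i₂ transpose-i₂) (trans (δ-offDiagonal i₂≢i₁) (E-at swap₂ (at₂ ≡.refl) (at₂ ≡.refl)))
    entries {r} (off r≢i₁ r≢i₂) (at₁ ≡.refl) = trans (δ-transpose r i₁ transpose-i₁)
      (trans (δ-offDiagonal r≢i₂) (sym (trans (E-offRow swap₂ i₁ r≢i₁ r≢i₂) (δ-offDiagonal r≢i₁))))
    entries {r} (off r≢i₁ r≢i₂) (at₂ ≡.refl) = trans (δ-transpose r i₂ transpose-i₂)
      (trans (δ-offDiagonal r≢i₁) (sym (trans (E-offRow swap₂ i₂ r≢i₁ r≢i₂) (δ-offDiagonal r≢i₂))))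

  f-corner : ∀ t → f i t i₂ i₁ ≡ t
  f-corner t with i₂ ≟ i₂ | i₁ ≟ i₁
  ... | yes _    | yes _    = ≡.refl
  ... | no i₂≢i₂ | _        = ⊥-elim (i₂≢i₂ ≡.refl)
  ... | yes _    | no i₁≢i₁ = ⊥-elim (i₁≢i₁ ≡.refl)

  f-offCorner : ∀ t {r k} → r ≢ i₂ ⊎ k ≢ i₁ → f i t r k ≡ δ r k
  f-offCorner t {r} {k} off-corner with r ≟ i₂ | k ≟ i₁
  ... | no _     | _        = ≡.refl
  ... | yes _    | no _     = ≡.refl
  ... | yes r≡i₂ | yes k≡i₁ with off-corner
  ...   | inj₁ r≢i₂ = ⊥-elim (r≢i₂ r≡i₂)
  ...   | inj₂ k≢i₁ = ⊥-elim (k≢i₁ k≡i₁)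

  f≋E-lower₂ : ∀ t → f i t ≋ E (lower₂ t)
  f≋E-lower₂ t = ⟪ (λ r k → entries (pos r) (pos k)) ⟫
    where
    f≡δ : ∀ r k → r ≢ i₂ ⊎ k ≢ i₁ → f i t r k ≈ δ r k
    f≡δ r k off-corner = reflexive (f-offCorner t off-corner)
    entries : ∀ {r k} (pr : Pos r) (pk : Pos k) → f i t r k ≈ E (lower₂ t) r k
    entries {r} {k} (off r≢i₁ r≢i₂) pk = trans (f≡δ r k (inj₁ r≢i₂)) (sym (E-offRow (lower₂ t) k r≢i₁ r≢i₂))
    entries {r} {k} pr (off k≢i₁ k≢i₂) = trans (f≡δ r k (inj₂ k≢i₁)) (sym (E-offColumn (lower₂ t) r k≢i₁ k≢i₂))
    entries (at₂ ≡.refl) (at₁ ≡.refl) = trans (reflexive (f-corner t)) (E-at (lower₂ t) (at₂ ≡.refl) (at₁ ≡.refl))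
    entries (at₁ ≡.refl) (at₁ ≡.refl) =
      trans (f≡δ i₁ i₁ (inj₁ i₁≢i₂)) (trans (δ-diagonal i₁) (E-at (lower₂ t) (at₁ ≡.refl) (at₁ ≡.refl)))
    entries (at₁ ≡.refl) (at₂ ≡.refl) =
      trans (f≡δ i₁ i₂ (inj₁ i₁≢i₂)) (trans (δ-offDiagonal i₁≢i₂) (E-at (lower₂ t) (at₁ ≡.refl) (at₂ ≡.refl)))
    entries (at₂ ≡.refl) (at₂ ≡.refl) =
      trans (f≡δ i₂ i₂ (inj₂ i₂≢i₁)) (trans (δ-diagonal i₂) (E-at (lower₂ t) (at₂ ≡.refl) (at₂ ≡.refl)))

  -- The shape of the minimal parabolic subgroup B ∪ B s_i B.
  ParabolicShape : Mat → Set ℓ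
  ParabolicShape A = ∀ r k → k < r → r ≢ i₂ ⊎ k ≢ i₁ → A r k ≈ 0#

  offCorner-column : ∀ {r k} → r ≢ i₂ ⊎ k ≢ i₁ → r ≡ i₂ → k ≢ i₁
  offCorner-column (inj₁ r≢i₂) r≡i₂ = ⊥-elim (r≢i₂ r≡i₂)
  offCorner-column (inj₂ k≢i₁) _    = k≢i₁

  offCorner-row : ∀ {r k} → r ≢ i₂ ⊎ k ≢ i₁ → k ≡ i₁ → r ≢ i₂
  offCorner-row (inj₁ r≢i₂) _    = r≢i₂
  offCorner-row (inj₂ k≢i₁) k≡i₁ = ⊥-elim (k≢i₁ k≡i₁)

  ParabolicShape-resp-≋ : ∀ {A B} → A ≋ B → ParabolicShape A → ParabolicShape B
  ParabolicShape-resp-≋ A≋B A-shape r k k<r off-corner = trans (sym (entry A≋B r k)) (A-shape r k k<r off-corner)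

  upper⇒parabolic : ∀ {A} → UpperTriangular A → ParabolicShape A
  upper⇒parabolic A-upper r k k<r _ = A-upper r k k<r

  parabolic⇒upper : ∀ {A} → ParabolicShape A → A i₂ i₁ ≈ 0# → UpperTriangular A
  parabolic⇒upper A-shape corner r k k<r with r ≟ i₂ | k ≟ i₁
  ... | yes ≡.refl | yes ≡.refl = corner
  ... | no r≢i₂    | _          = A-shape r k k<r (inj₁ r≢i₂)
  ... | yes _      | no k≢i₁    = A-shape r k k<r (inj₂ k≢i₁)

  E·-parabolic : ∀ N {A} → ParabolicShape A → ParabolicShape (E N · A)
  E·-parabolic N {A} A-shape r k k<r off-corner = byRow (pos r)
    where
    rows-vanish : k < i₁ → ∀ {x y} → x * A i₁ k + y * A i₂ k ≈ 0#
    rows-vanish k<i₁ = combination≈0 (A-shape i₁ k k<i₁ (inj₁ i₁≢i₂)) (A-shape i₂ k (ℕP.<-trans k<i₁ i₁<i₂) (inj₂ (FinP.<⇒≢ k<i₁)))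
    byRow : Pos r → (E N · A) r k ≈ 0#
    byRow (at₁ ≡.refl) = trans (E·-row₁ N A k) (rows-vanish k<r)
    byRow (at₂ ≡.refl) = trans (E·-row₂ N A k) (rows-vanish (<i₂⇒<i₁ (offCorner-column off-corner ≡.refl) k<r))
    byRow (off r≢i₁ r≢i₂) = trans (E·-offRow N A k r≢i₁ r≢i₂) (A-shape r k k<r off-corner)

  ·E-parabolic : ∀ Q {A} → ParabolicShape A → ParabolicShape (A · E Q)
  ·E-parabolic Q {A} A-shape r k k<r off-corner = byColumn (pos k)
    where
    columns-vanish : i₂ < r → ∀ {x y} → A r i₁ * x + A r i₂ * y ≈ 0#
    columns-vanish i₂<r = combination≈0′ (A-shape r i₁ (ℕP.<-trans i₁<i₂ i₂<r) (inj₁ (FinP.<⇒≢ i₂<r ∘ ≡.sym)))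
                                         (A-shape r i₂ i₂<r (inj₂ i₂≢i₁))
    byColumn : Pos k → (A · E Q) r k ≈ 0#
    byColumn (at₁ ≡.refl) = trans (·E-column₁ A Q r) (columns-vanish (i₁<⇒i₂< (offCorner-row off-corner ≡.refl) k<r))
    byColumn (at₂ ≡.refl) = trans (·E-column₂ A Q r) (columns-vanish k<r)
    byColumn (off k≢i₁ k≢i₂) = trans (·E-offColumn A Q r k≢i₁ k≢i₂) (A-shape r k k<r off-corner)

  E-upper : ∀ M → e₂₁ M ≈ 0# → UpperTriangular (E M)
  E-upper M corner = parabolic⇒upper
    (ParabolicShape-resp-≋ (·-identityʳ (E M)) (E·-parabolic M (upper⇒parabolic UpperTriangular-I)))
    (trans (E-entry M (at₂ ≡.refl) (at₁ ≡.refl)) corner)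

  block : Mat → M₂
  block b = m₂ (b i₁ i₁) (b i₁ i₂) (b i₂ i₁) (b i₂ i₂)

  E·b·E-upper : ∀ N Q {b} → UpperTriangular b → e₂₁ ((N ⊙ block b) ⊙ Q) ≈ 0# → UpperTriangular ((E N · b) · E Q)
  E·b·E-upper N Q {b} b-upper corner = parabolic⇒upper
    (·E-parabolic Q (E·-parabolic N (upper⇒parabolic b-upper)))
    (trans (·E-column₁ (E N · b) Q i₂) (trans (+-cong (*-congʳ (E·-row₂ N b i₁)) (*-congʳ (E·-row₂ N b i₂))) corner))

module ProjectiveLine {c ℓ : Level} (F : FiniteField c ℓ) (m : ℕ) (i : Fin m) where
  open FiniteField F hiding (zero)
  open Hecke F m
  open Matrices F m
  open Cosets F m
  open Block F m i
  open RingProperties ring using (-0#≈0#; -‿distribˡ-*)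

  x≉0∧y≉0⇒x*y≉0 : ∀ {x y} → ¬ x ≈ 0# → ¬ y ≈ 0# → ¬ (x * y) ≈ 0#
  x≉0∧y≉0⇒x*y≉0 {x} {y} x≉0 y≉0 x*y≈0 with inverse x x≉0
  ... | x⁻¹ , x*x⁻¹≈1 = y≉0 (begin
    y                ≈⟨ *-identityˡ y ⟨
    1# * y           ≈⟨ *-congʳ (trans (sym x*x⁻¹≈1) (*-comm x x⁻¹)) ⟩
    (x⁻¹ * x) * y    ≈⟨ *-assoc x⁻¹ x y ⟩
    x⁻¹ * (x * y)    ≈⟨ *-congˡ x*y≈0 ⟩
    x⁻¹ * 0#         ≈⟨ zeroʳ x⁻¹ ⟩
    0#               ∎)
    where open SetoidReasoning setoid

  -- The cosets g · mat p · B are the points of the projective line g P_i / B, where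
  -- P_i = B ∪ B s_i B; the point lower 0# is gB itself.
  data Point : Set c where
    swap  : Point
    lower : Carrier → Point

  point₂ : Point → M₂
  point₂ swap      = swap₂
  point₂ (lower t) = lower₂ t

  point₂⁻¹ : Point → M₂
  point₂⁻¹ swap      = swap₂
  point₂⁻¹ (lower t) = lower₂ (- t)

  mat : Point → Mat
  mat swap      = sM i
  mat (lower t) = f i t

  mat≋E : ∀ p → mat p ≋ E (point₂ p)
  mat≋E swap      = sM≋E-swap₂
  mat≋E (lower t) = f≋E-lower₂ t

  Nontrivial : Point → Set ℓ
  Nontrivial swap      = Lift ℓ ⊤
  Nontrivial (lower t) = ¬ t ≈ 0#

  infix 4 _≈ᵖ_
  _≈ᵖ_ : Point → Point → Set ℓ
  swap    ≈ᵖ swap    = Lift ℓ ⊤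
  lower t ≈ᵖ lower u = t ≈ u
  _       ≈ᵖ _       = Lift ℓ ⊥

  swap₂⊙swap₂ : swap₂ ⊙ swap₂ ≈₂ I₂
  swap₂⊙swap₂ = ≈₂⟨ trans (+-cong (zeroˡ 0#) (*-identityˡ 1#)) (+-identityˡ 1#)
                  , trans (+-cong (zeroˡ 1#) (*-identityˡ 0#)) (+-identityˡ 0#)
                  , trans (+-cong (*-identityˡ 0#) (zeroˡ 1#)) (+-identityˡ 0#)
                  , trans (+-cong (*-identityˡ 1#) (zeroˡ 0#)) (+-identityʳ 1#) ⟩

  lower₂-⊙ : ∀ t u → lower₂ t ⊙ lower₂ u ≈₂ lower₂ (t + u)
  lower₂-⊙ t u = ≈₂⟨ trans (+-cong (*-identityˡ 1#) (zeroˡ u)) (+-identityʳ 1#)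
                   , trans (+-cong (*-identityˡ 0#) (zeroˡ 1#)) (+-identityˡ 0#)
                   , +-cong (*-identityʳ t) (*-identityˡ u)
                   , trans (+-cong (zeroʳ t) (*-identityˡ 1#)) (+-identityˡ 1#) ⟩

  lower₂-0 : ∀ {t} → t ≈ 0# → lower₂ t ≈₂ I₂
  lower₂-0 t≈0 = ≈₂⟨ refl , refl , t≈0 , refl ⟩

  point₂⊙point₂⁻¹ : ∀ p → point₂ p ⊙ point₂⁻¹ p ≈₂ I₂
  point₂⊙point₂⁻¹ swap      = swap₂⊙swap₂
  point₂⊙point₂⁻¹ (lower t) = ≈₂-trans (lower₂-⊙ t (- t)) (lower₂-0 (-‿inverseʳ t))

  point₂⁻¹⊙point₂ : ∀ p → point₂⁻¹ p ⊙ point₂ p ≈₂ I₂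
  point₂⁻¹⊙point₂ swap      = swap₂⊙swap₂
  point₂⁻¹⊙point₂ (lower t) = ≈₂-trans (lower₂-⊙ (- t) t) (lower₂-0 (-‿inverseˡ t))

  Inv-E-point₂ : ∀ p → Inv (E (point₂ p))
  Inv-E-point₂ p = Inv-E (mkInv₂ (point₂⁻¹ p) (point₂⊙point₂⁻¹ p) (point₂⁻¹⊙point₂ p))

  Inv-E-point₂⁻¹ : ∀ p → Inv (E (point₂⁻¹ p))
  Inv-E-point₂⁻¹ p = Inv-E (mkInv₂ (point₂ p) (point₂⁻¹⊙point₂ p) (point₂⊙point₂⁻¹ p))

  Inv-mat : ∀ p → Inv (mat p)
  Inv-mat p = Inv-resp-≋ (≋-sym (mat≋E p)) (Inv-E-point₂ p)

  E-point₂⊙point₂⁻¹ : ∀ p → E (point₂ p) · E (point₂⁻¹ p) ≋ I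
  E-point₂⊙point₂⁻¹ p = ≋-trans (E-⊙ (point₂ p) (point₂⁻¹ p)) (≋-trans (E-cong (point₂⊙point₂⁻¹ p)) E-I₂)

  E-point₂⁻¹⊙point₂ : ∀ p → E (point₂⁻¹ p) · E (point₂ p) ≋ I
  E-point₂⁻¹⊙point₂ p = ≋-trans (E-⊙ (point₂⁻¹ p) (point₂ p)) (≋-trans (E-cong (point₂⁻¹⊙point₂ p)) E-I₂)

  ⊙-assoc₂₁ : ∀ M N Q → e₂₁ ((M ⊙ N) ⊙ Q) ≈ e₂₁ M * e₁₁ (N ⊙ Q) + e₂₂ M * e₂₁ (N ⊙ Q)
  ⊙-assoc₂₁ (m₂ _ _ a b) (m₂ n₁₁ n₁₂ n₂₁ n₂₂) (m₂ q₁₁ _ q₂₁ _) = begin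
    (a * n₁₁ + b * n₂₁) * q₁₁ + (a * n₁₂ + b * n₂₂) * q₂₁
      ≈⟨ +-cong (distribʳ q₁₁ _ _) (distribʳ q₂₁ _ _) ⟩
    (a * n₁₁ * q₁₁ + b * n₂₁ * q₁₁) + (a * n₁₂ * q₂₁ + b * n₂₂ * q₂₁)
      ≈⟨ interchange _ _ _ _ ⟩
    (a * n₁₁ * q₁₁ + a * n₁₂ * q₂₁) + (b * n₂₁ * q₁₁ + b * n₂₂ * q₂₁)
      ≈⟨ +-cong (trans (+-cong (*-assoc _ _ _) (*-assoc _ _ _)) (sym (distribˡ a _ _)))
                (trans (+-cong (*-assoc _ _ _) (*-assoc _ _ _)) (sym (distribˡ b _ _))) ⟩
    a * (n₁₁ * q₁₁ + n₁₂ * q₂₁) + b * (n₂₁ * q₁₁ + n₂₂ * q₂₁) ∎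
    where
    open SetoidReasoning setoid
    open CommutativeSemigroupProperties +-commutativeSemigroup using (interchange)

  -- With (x , y) the first column of the 2 × 2 block of b · E Q, the matrix E (point₂⁻¹ p) · b · E Q
  -- lies in B as soon as its corner entry -t x + y (or x, for p = swap) vanishes.
  module Classification {b : Mat} (b∈B : IsB b) (Q : M₂) (EQ-inv : Inv (E Q)) where
    x y : Carrier
    x = e₁₁ (block b ⊙ Q)
    y = e₂₁ (block b ⊙ Q)

    mat∼ : ∀ p → e₂₁ (point₂⁻¹ p) * x + e₂₂ (point₂⁻¹ p) * y ≈ 0# → mat p ∼ b · E Q
    mat∼ p corner≈0 = mk∼ (mkB X-inv X-upper) (≋-sym mat·X≋b·EQ)
      where
      X : Mat
      X = (E (point₂⁻¹ p) · b) · E Q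
      X-inv : Inv X
      X-inv = Inv-· (Inv-· (Inv-E-point₂⁻¹ p) (invB b∈B)) EQ-inv
      X-upper : UpperTriangular X
      X-upper = E·b·E-upper (point₂⁻¹ p) Q (upperB b∈B) (trans (⊙-assoc₂₁ (point₂⁻¹ p) (block b) Q) corner≈0)
      mat·X≋b·EQ : mat p · X ≋ b · E Q
      mat·X≋b·EQ = begin
        mat p · X                                          ≈⟨ ·-congʳ X (mat≋E p) ⟩
        E (point₂ p) · ((E (point₂⁻¹ p) · b) · E Q)        ≈⟨ ·-assoc (E (point₂ p)) (E (point₂⁻¹ p) · b) (E Q) ⟨
        (E (point₂ p) · (E (point₂⁻¹ p) · b)) · E Q        ≈⟨ ·-congʳ (E Q) (·-cancelˡ (E (point₂ p)) (E (point₂⁻¹ p)) b (E-point₂⊙point₂⁻¹ p)) ⟩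
        b · E Q                                            ∎
        where open ≋-Reasoning

    record Classified : Set (c ⊔ ℓ) where
      field
        point      : Point
        mat∼b·EQ   : mat point ∼ b · E Q
        y≉0⇒nontrivial : ¬ y ≈ 0# → Nontrivial point
        nontrivial⊎identity : Nontrivial point ⊎ point ≈ᵖ lower 0#

    classify : Classified
    classify with y ≟F 0#
    ... | yes y≈0 = record
      { point = lower 0# ; mat∼b·EQ = mat∼ (lower 0#) corner≈0
      ; y≉0⇒nontrivial = λ y≉0 → ⊥-elim (y≉0 y≈0) ; nontrivial⊎identity = inj₂ refl }
      where
      corner≈0 : - 0# * x + 1# * y ≈ 0#
      corner≈0 = trans (+-cong (trans (*-congʳ -0#≈0#) (zeroˡ x)) (trans (*-identityˡ y) y≈0)) (+-identityˡ 0#)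
    ... | no y≉0 with x ≟F 0#
    ...   | yes x≈0 = record
      { point = swap ; mat∼b·EQ = mat∼ swap corner≈0
      ; y≉0⇒nontrivial = λ _ → lift tt ; nontrivial⊎identity = inj₁ (lift tt) }
      where
      corner≈0 : 1# * x + 0# * y ≈ 0#
      corner≈0 = trans (+-cong (trans (*-identityˡ x) x≈0) (zeroˡ y)) (+-identityˡ 0#)
    ...   | no x≉0 with inverse x x≉0
    ...     | x⁻¹ , x*x⁻¹≈1 = record
      { point = lower t ; mat∼b·EQ = mat∼ (lower t) corner≈0
      ; y≉0⇒nontrivial = λ _ → t≉0 ; nontrivial⊎identity = inj₁ t≉0 }
      where
      t : Carrier
      t = y * x⁻¹
      t≉0 : ¬ t ≈ 0#
      t≉0 = x≉0∧y≉0⇒x*y≉0 y≉0 (x*y≈1⇒y≉0 x*x⁻¹≈1)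
      corner≈0 : - t * x + 1# * y ≈ 0#
      corner≈0 = begin
        - t * x + 1# * y        ≈⟨ +-cong (sym (-‿distribˡ-* t x)) (*-identityˡ y) ⟩
        - (t * x) + y           ≈⟨ +-congʳ (-‿cong (trans (*-assoc y x⁻¹ x) (trans (*-congˡ (trans (*-comm x⁻¹ x) x*x⁻¹≈1)) (*-identityʳ y)))) ⟩
        - y + y                 ≈⟨ -‿inverseˡ y ⟩
        0#                      ∎
        where open SetoidReasoning setoid

module NonzeroElements {c ℓ : Level} (F : FiniteField c ℓ) where
  open FiniteField F hiding (zero)

  ≉0? : ∀ t → Dec (¬ t ≈ 0#)
  ≉0? t = ¬? (t ≟F 0#)

  nonzero-≉0 : All (λ t → ¬ t ≈ 0#) nonzero
  nonzero-≉0 = AllProperties.all-filter ≉0? elements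

  ∈-nonzero : ∀ {t} → ¬ t ≈ 0# → Any (t ≈_) nonzero
  ∈-nonzero {t} t≉0 = MembershipProperties.∈-filter⁺ setoid ≉0? (λ x≈y x≉0 y≈0 → x≉0 (trans x≈y y≈0)) (complete t) t≉0

  nonzero-unique : AllPairs (λ s t → ¬ s ≈ t) nonzero
  nonzero-unique = AllPairsProperties.filter⁺ ≉0? distinct

  size≡1+length-nonzero : size ≡ suc (length nonzero)
  size≡1+length-nonzero = length-filter elements distinct (complete 0#)
    where
    length-filter : ∀ xs → AllPairs (λ s t → ¬ s ≈ t) xs → Any (0# ≈_) xs →
                    length xs ≡ suc (length (filter ≉0? xs))
    length-filter (x ∷ xs) (x≉xs ∷ xs!) 0∈x∷xs with x ≟F 0#
    ... | yes x≈0 = ≡.cong (suc ∘ length)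
                      (≡.sym (List.filter-all ≉0? (All.map (λ x≉y y≈0 → x≉y (trans x≈0 (sym y≈0))) x≉xs)))
    ... | no x≉0 = ≡.cong suc (length-filter xs xs! (Any.tail (λ 0≈x → x≉0 (sym 0≈x)) 0∈x∷xs))

module HeckeLine {c ℓ : Level} (F : FiniteField c ℓ) (m : ℕ) (i : Fin m) where
  open FiniteField F hiding (zero)
  open Hecke F m
  open Matrices F m
  open Cosets F m
  open Block F m i
  open ProjectiveLine F m i
  open NonzeroElements F
  open SetoidLists ∼-setoid
  open ≋-Reasoning
  open RingProperties ring using (x∙y⁻¹≈ε⇒x≈y)

  points : List Point
  points = swap ∷ map lower nonzero

  T₁≡map : ∀ g → T₁ i g ≡ map (λ p → g · mat p) points
  T₁≡map g = ≡.cong (g · sM i ∷_) (List.map-∘ nonzero)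

  points-nontrivial : All Nontrivial points
  points-nontrivial = lift tt ∷ AllProperties.map⁺ nonzero-≉0

  ∈-points : ∀ p → Nontrivial p → Any (p ≈ᵖ_) points
  ∈-points swap      _   = here (lift tt)
  ∈-points (lower t) t≉0 = there (AnyProperties.map⁺ (∈-nonzero t≉0))

  points-unique : AllPairs (λ p q → ¬ p ≈ᵖ q) points
  points-unique = AllProperties.map⁺ (All.universal (λ _ ()) nonzero) ∷ AllPairsProperties.map⁺ nonzero-unique

  ≈ᵖ⇒≋ : ∀ p q → p ≈ᵖ q → mat p ≋ mat q
  ≈ᵖ⇒≋ swap      swap      _   = ≋-refl
  ≈ᵖ⇒≋ (lower t) (lower u) t≈u = ≋-trans (f≋E-lower₂ t) (≋-trans (E-cong ≈₂⟨ refl , refl , t≈u , refl ⟩) (≋-sym (f≋E-lower₂ u)))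

  ·mat-identity : ∀ g → g · mat (lower 0#) ≋ g
  ·mat-identity g = ≋-trans (·-congˡ g (≋-trans (f≋E-lower₂ 0#) (≋-trans (E-cong (lower₂-0 refl)) E-I₂))) (·-identityʳ g)

  corner⇒≈ᵖ : ∀ p q → e₂₁ (point₂⁻¹ p ⊙ point₂ q) ≈ 0# → p ≈ᵖ q
  corner⇒≈ᵖ swap      swap      _ = lift tt
  corner⇒≈ᵖ swap      (lower u) corner≈0 =
    ⊥-elim (1≉0 (trans (sym (trans (+-cong (*-identityˡ 1#) (zeroˡ u)) (+-identityʳ 1#))) corner≈0))
  corner⇒≈ᵖ (lower t) swap      corner≈0 =
    ⊥-elim (1≉0 (trans (sym (trans (+-cong (zeroʳ (- t)) (*-identityˡ 1#)) (+-identityˡ 1#))) corner≈0))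
  corner⇒≈ᵖ (lower t) (lower u) corner≈0 =
    sym (x∙y⁻¹≈ε⇒x≈y u t (trans (+-comm u (- t)) (trans (+-cong (sym (*-identityʳ (- t))) (sym (*-identityˡ u))) corner≈0)))

  -- If g · mat p and g · mat q span the same coset, then E (point₂⁻¹ p) · mat q lies in B,
  -- so its corner entry vanishes.
  mat-injective : ∀ {g} → Inv g → ∀ p q → g · mat p ∼ g · mat q → p ≈ᵖ q
  mat-injective {g} g-inv p q (mk∼ {X} X∈B g·q≋g·p·X) = corner⇒≈ᵖ p q
    (trans (E-at (point₂⁻¹ p ⊙ point₂ q) (at₂ ≡.refl) (at₁ ≡.refl))
    (trans (sym (entry (E-⊙ (point₂⁻¹ p) (point₂ q)) i₂ i₁))
    (trans (entry (·-congˡ (E (point₂⁻¹ p)) (≋-sym (mat≋E q))) i₂ i₁)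
    (trans (entry E⁻¹·q≋X i₂ i₁) (upperB X∈B i₂ i₁ i₁<i₂)))))
    where
    g⁻¹ : Mat
    g⁻¹ = inv g-inv
    q≋p·X : mat q ≋ mat p · X
    q≋p·X = begin
      mat q                    ≈⟨ ·-cancelˡ g⁻¹ g (mat q) (inverseˡ g-inv) ⟨
      g⁻¹ · (g · mat q)        ≈⟨ ·-congˡ g⁻¹ (≋-trans g·q≋g·p·X (·-assoc g (mat p) X)) ⟩
      g⁻¹ · (g · (mat p · X))  ≈⟨ ·-cancelˡ g⁻¹ g (mat p · X) (inverseˡ g-inv) ⟩
      mat p · X                ∎
    E⁻¹·q≋X : E (point₂⁻¹ p) · mat q ≋ X
    E⁻¹·q≋X = begin
      E (point₂⁻¹ p) · mat q                   ≈⟨ ·-congˡ (E (point₂⁻¹ p)) q≋p·X ⟩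
      E (point₂⁻¹ p) · (mat p · X)             ≈⟨ ·-congˡ (E (point₂⁻¹ p)) (·-congʳ X (mat≋E p)) ⟩
      E (point₂⁻¹ p) · (E (point₂ p) · X)      ≈⟨ ·-cancelˡ (E (point₂⁻¹ p)) (E (point₂ p)) X (E-point₂⁻¹⊙point₂ p) ⟩
      X                                        ∎

  -- The corner entry of the block of b · E (point₂ p) is b₂₂ e₂₁ ≠ 0.
  b·mat∼mat : ∀ {b} → IsB b → ∀ p → Nontrivial p → Σ Point λ p′ → Nontrivial p′ × mat p′ ∼ b · mat p
  b·mat∼mat {b} b∈B p p-nontrivial =
    point , y≉0⇒nontrivial y≉0 , ∼-resp-≋ ≋-refl (·-congˡ b (≋-sym (mat≋E p))) mat∼b·EQ
    where
    open Classification b∈B (point₂ p) (Inv-E-point₂ p)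
    open Classified classify
    e₂₁≉0 : ∀ p → Nontrivial p → ¬ e₂₁ (point₂ p) ≈ 0#
    e₂₁≉0 swap      _   = 1≉0
    e₂₁≉0 (lower t) t≉0 = t≉0
    y≉0 : ¬ y ≈ 0#
    y≉0 y≈0 = x≉0∧y≉0⇒x*y≉0 (IsB-diagonal≉0 b∈B i₂) (e₂₁≉0 p p-nontrivial)
      (trans (sym (trans (+-congʳ (trans (*-congʳ (upperB b∈B i₂ i₁ i₁<i₂)) (zeroˡ _))) (+-identityˡ _))) y≈0)

  ∼·mat∼·mat : ∀ {g g′} → g ∼ g′ → ∀ p → Nontrivial p → Σ Point λ p′ → Nontrivial p′ × g · mat p′ ∼ g′ · mat p
  ∼·mat∼·mat {g} {g′} (mk∼ {b} b∈B g′≋g·b) p p-nontrivial =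
    let p′ , p′-nontrivial , p′∼b·p = b·mat∼mat b∈B p p-nontrivial
    in p′ , p′-nontrivial , ∼-trans (·-congˡ-∼ g p′∼b·p)
                              (≋⇒∼ (≋-trans (≋-sym (·-assoc g b (mat p))) (·-congʳ (mat p) (≋-sym g′≋g·b))))

  ∈-T₁ : ∀ g {z} p → Nontrivial p → z ∼ g · mat p → z ∈ T₁ i g
  ∈-T₁ g {z} p p-nontrivial z∼g·p = ≡.subst (z ∈_) (≡.sym (T₁≡map g))
    (AnyProperties.map⁺ (Any.map (λ {q} p≈q → ∼-trans z∼g·p (≋⇒∼ (·-congˡ g (≈ᵖ⇒≋ p q p≈q)))) (∈-points p p-nontrivial)))

  T₁-All : ∀ {r} (Q : Mat → Set r) g → (∀ p → Nontrivial p → Q (g · mat p)) → All Q (T₁ i g)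
  T₁-All Q g Q-points = ≡.subst (All Q) (≡.sym (T₁≡map g)) (AllProperties.map⁺ (All.map (Q-points _) points-nontrivial))

  T₁-unique : ∀ {g} → Inv g → Unique (T₁ i g)
  T₁-unique {g} g-inv = ≡.subst Unique (≡.sym (T₁≡map g))
    (AllPairsProperties.map⁺ (AllPairs.map (λ {p} {q} p≉q g·p∼g·q → p≉q (mat-injective g-inv p q g·p∼g·q)) points-unique))

  T₁-resp-∼ : ∀ {g g′} → Inv g → g ∼ g′ → T₁ i g ↭ T₁ i g′
  T₁-resp-∼ {g} {g′} g-inv g∼g′ = unique-⊆-⊇⇒↭ (T₁-unique g-inv) (T₁-unique (Inv-resp-∼ g-inv g∼g′))
    (covered g∼g′ (∼-sym g∼g′)) (covered (∼-sym g∼g′) g∼g′)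
    where
    covered : ∀ {h h′} → h ∼ h′ → h′ ∼ h → All (_∈ T₁ i h′) (T₁ i h)
    covered {h} {h′} _ h′∼h = T₁-All (_∈ T₁ i h′) h (λ p p-nontrivial →
      let p′ , p′-nontrivial , h′·p′∼h·p = ∼·mat∼·mat h′∼h p p-nontrivial
      in ∈-T₁ h′ p′ p′-nontrivial (∼-sym h′·p′∼h·p))

  Line : Mat → List Mat
  Line g = g ∷ T₁ i g

  Line-unique : ∀ {g} → Inv g → Unique (Line g)
  Line-unique {g} g-inv = T₁-All _ g g≁g·p ∷ T₁-unique g-inv
    where
    g≁g·p : ∀ p → Nontrivial p → ¬ g ∼ g · mat p
    g≁g·p swap      _   g∼g·s with mat-injective g-inv (lower 0#) swap (∼-trans (≋⇒∼ (·mat-identity g)) g∼g·s)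
    ... | ()
    g≁g·p (lower t) t≉0 g∼g·f = t≉0 (sym (mat-injective g-inv (lower 0#) (lower t) (∼-trans (≋⇒∼ (·mat-identity g)) g∼g·f)))

  ∈-Line : ∀ g {z} Q → Inv (E Q) → z ∼ g · E Q → z ∈ Line g
  ∈-Line g {z} Q EQ-inv z∼g·EQ = by nontrivial⊎identity
    where
    open Classification IsB-I Q EQ-inv using (module Classified; classify)
    open Classified classify
    z∼g·p : z ∼ g · mat point
    z∼g·p = ∼-trans z∼g·EQ (∼-sym (∼-resp-≋ ≋-refl (·-congˡ g (·-identityˡ (E Q))) (·-congˡ-∼ g mat∼b·EQ)))
    by : Nontrivial point ⊎ point ≈ᵖ lower 0# → z ∈ Line g
    by (inj₁ p-nontrivial) = there (∈-T₁ g point p-nontrivial z∼g·p)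
    by (inj₂ p≈ᵖ0)         = here (∼-trans z∼g·p (≋⇒∼ (≋-trans (·-congˡ g (≈ᵖ⇒≋ point (lower 0#) p≈ᵖ0)) (·mat-identity g))))

  Inv-E-⊙ : ∀ {M N} → Inv (E M) → Inv (E N) → Inv (E (M ⊙ N))
  Inv-E-⊙ {M} {N} EM-inv EN-inv = Inv-resp-≋ (E-⊙ M N) (Inv-· EM-inv EN-inv)

  ·E-⊙ : ∀ g M N → (g · E M) · E N ≋ g · E (M ⊙ N)
  ·E-⊙ g M N = ≋-trans (·-assoc g (E M) (E N)) (·-congˡ g (E-⊙ M N))

  -- Every point of either line is g · E Q for an invertible 2 × 2 matrix Q.
  Line-·mat : ∀ {g} → Inv g → ∀ p → Line (g · mat p) ↭ Line g
  Line-·mat {g} g-inv p = unique-⊆-⊇⇒↭ (Line-unique x-inv) (Line-unique g-inv) x-line⊆g-line g-line⊆x-line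
    where
    x : Mat
    x = g · mat p
    x-inv : Inv x
    x-inv = Inv-· g-inv (Inv-mat p)
    x≋g·E : x ≋ g · E (point₂ p)
    x≋g·E = ·-congˡ g (mat≋E p)
    g≋x·E⁻¹ : g ≋ x · E (point₂⁻¹ p)
    g≋x·E⁻¹ = ≋-sym (begin
      x · E (point₂⁻¹ p)                 ≈⟨ ·-congʳ (E (point₂⁻¹ p)) x≋g·E ⟩
      (g · E (point₂ p)) · E (point₂⁻¹ p) ≈⟨ ·-cancelʳ g (E (point₂ p)) (E (point₂⁻¹ p)) (E-point₂⊙point₂⁻¹ p) ⟩
      g                                  ∎)
    x-line⊆g-line : All (_∈ Line g) (Line x)
    x-line⊆g-line = ∈-Line g (point₂ p) (Inv-E-point₂ p) (≋⇒∼ x≋g·E)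
      ∷ T₁-All _ x (λ p′ _ → ∈-Line g (point₂ p ⊙ point₂ p′) (Inv-E-⊙ (Inv-E-point₂ p) (Inv-E-point₂ p′))
          (≋⇒∼ (≋-trans (·-cong x≋g·E (mat≋E p′)) (·E-⊙ g (point₂ p) (point₂ p′)))))
    g-line⊆x-line : All (_∈ Line x) (Line g)
    g-line⊆x-line = ∈-Line x (point₂⁻¹ p) (Inv-E-point₂⁻¹ p) (≋⇒∼ g≋x·E⁻¹)
      ∷ T₁-All _ g (λ p′ _ → ∈-Line x (point₂⁻¹ p ⊙ point₂ p′) (Inv-E-⊙ (Inv-E-point₂⁻¹ p) (Inv-E-point₂ p′))
          (≋⇒∼ (≋-trans (·-cong g≋x·E⁻¹ (mat≋E p′)) (·E-⊙ x (point₂⁻¹ p) (point₂ p′)))))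

  length-T₁ : ∀ g → length (T₁ i g) ≡ size
  length-T₁ g = ≡.trans (≡.cong suc (List.length-map (λ t → g · f i t) nonzero)) (≡.sym size≡1+length-nonzero)

  T-T₁ : ∀ {g} → Inv g → T i (T₁ i g) ↭ size times [ g ] ++ (size ∸ 1) times T₁ i g
  T-T₁ {g} g-inv = ≡.subst (λ k → T i (T₁ i g) ↭ k times [ g ] ++ (k ∸ 1) times T₁ i g) (length-T₁ g)
    (concatMap-complements (T₁ i) g (T₁ i g) (T₁-All _ g (λ p _ → Line-·mat g-inv p)))

module BruhatCells {c ℓ : Level} (F : FiniteField c ℓ) (m : ℕ) (i : Fin m) where
  open FiniteField F hiding (zero)
  open Hecke F m
  open Matrices F m
  open Cosets F m
  open Block F m i
  open ProjectiveLine F m i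
  open ≋-Reasoning
  open RingProperties ring using (-‿distribˡ-*; -‿distribʳ-*; -‿involutive)

  Ascent Descent : Permutation′ n → Set
  Ascent σ  = σ ⟨$⟩ʳ i₁ < σ ⟨$⟩ʳ i₂
  Descent σ = σ ⟨$⟩ʳ i₂ < σ ⟨$⟩ʳ i₁

  σs-i₁ : ∀ σ → (σ s i) ⟨$⟩ʳ i₁ ≡ σ ⟨$⟩ʳ i₂
  σs-i₁ σ = ≡.cong (σ ⟨$⟩ʳ_) transpose-i₁

  σs-i₂ : ∀ σ → (σ s i) ⟨$⟩ʳ i₂ ≡ σ ⟨$⟩ʳ i₁
  σs-i₂ σ = ≡.cong (σ ⟨$⟩ʳ_) transpose-i₂

  σss≗σ : ∀ σ j → ((σ s i) s i) ⟨$⟩ʳ j ≡ σ ⟨$⟩ʳ j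
  σss≗σ σ j = ≡.cong (σ ⟨$⟩ʳ_) (transpose-involutive j)

  descent⇒ascent-σs : ∀ {σ} → Descent σ → Ascent (σ s i)
  descent⇒ascent-σs {σ} = ≡.subst₂ _<_ (≡.sym (σs-i₁ σ)) (≡.sym (σs-i₂ σ))

  ascent⇒descent-σs : ∀ {σ} → Ascent σ → Descent (σ s i)
  ascent⇒descent-σs {σ} = ≡.subst₂ _<_ (≡.sym (σs-i₂ σ)) (≡.sym (σs-i₁ σ))

  P·sM : ∀ σ → P σ · sM i ≋ P (σ s i)
  P·sM σ = P-∘ₚ σ (Perm.transpose i₁ i₂)

  L·P·sM≋L·Pσs : ∀ σ L → (L · P σ) · sM i ≋ L · P (σ s i)
  L·P·sM≋L·Pσs σ L = ≋-trans (·-assoc L (P σ) (sM i)) (·-congˡ L (P·sM σ))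

  Cell-·sM : ∀ σ {L} → IsB⁻ L → Cell (σ s i) ((L · P σ) · sM i)
  Cell-·sM σ {L} L∈B⁻ = Cell-resp-∼ (Cell-b⁻P {σ s i} L∈B⁻) (≋⇒∼ (≋-sym (L·P·sM≋L·Pσs σ L)))

  -- The only off-diagonal entry of the conjugate sits at (σ i₂ , σ i₁), below the diagonal for an ascent.
  conjugate-f-lower : ∀ σ t → Ascent σ → LowerTriangular (conjugate σ (f i t))
  conjugate-f-lower σ t ascent r k r<k = trans (conjugate-entry σ (f i t) r k)
    (trans (reflexive (f-offCorner t offCorner)) (δ-offDiagonal σ⁻¹r≢σ⁻¹k))
    where
    σ⁻¹r≢σ⁻¹k : σ ⟨$⟩ˡ r ≢ σ ⟨$⟩ˡ k
    σ⁻¹r≢σ⁻¹k eq = FinP.<⇒≢ r<k (≡.trans (≡.sym (Perm.inverseʳ σ)) (≡.trans (≡.cong (σ ⟨$⟩ʳ_) eq) (Perm.inverseʳ σ)))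
    offCorner : σ ⟨$⟩ˡ r ≢ i₂ ⊎ σ ⟨$⟩ˡ k ≢ i₁
    offCorner with σ ⟨$⟩ˡ r ≟ i₂ | σ ⟨$⟩ˡ k ≟ i₁
    ... | no σ⁻¹r≢i₂ | _          = inj₁ σ⁻¹r≢i₂
    ... | yes _      | no σ⁻¹k≢i₁ = inj₂ σ⁻¹k≢i₁
    ... | yes σ⁻¹r≡i₂ | yes σ⁻¹k≡i₁ = ⊥-elim (ℕP.<-asym r<k (≡.subst₂ _<_ (σ-back σ⁻¹k≡i₁) (σ-back σ⁻¹r≡i₂) ascent))
      where
      σ-back : ∀ {x y} → σ ⟨$⟩ˡ x ≡ y → σ ⟨$⟩ʳ y ≡ x
      σ-back eq = ≡.trans (≡.cong (σ ⟨$⟩ʳ_) (≡.sym eq)) (Perm.inverseʳ σ)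

  Cell-·f-ascent : ∀ σ {L} t → Ascent σ → IsB⁻ L → Cell σ ((L · P σ) · f i t)
  Cell-·f-ascent σ {L} t ascent L∈B⁻ = Cell-resp-∼ (Cell-b⁻P {σ} (IsB⁻-· L∈B⁻ C∈B⁻)) (≋⇒∼ L·C·P≋L·P·f)
    where
    C : Mat
    C = conjugate σ (f i t)
    C∈B⁻ : IsB⁻ C
    C∈B⁻ = mkB⁻ (Inv-conjugate σ (Inv-mat (lower t))) (conjugate-f-lower σ t ascent)
    L·C·P≋L·P·f : (L · C) · P σ ≋ (L · P σ) · f i t
    L·C·P≋L·P·f = begin
      (L · C) · P σ      ≈⟨ ·-assoc L C (P σ) ⟩
      L · (C · P σ)      ≈⟨ ·-congˡ L (P·≋conjugate·P σ (f i t)) ⟨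
      L · (P σ · f i t)  ≈⟨ ·-assoc L (P σ) (f i t) ⟨
      (L · P σ) · f i t  ∎

  -- For t ≠ 0, f_i(t) = s_i f_i(t⁻¹) E upper₂, since
  -- [[0,1],[1,0]] [[1,0],[t⁻¹,1]] [[t,1],[0,-t⁻¹]] = [[1,0],[t,1]].
  module FactorLower (t : Carrier) (t≉0 : ¬ t ≈ 0#) where
    t⁻¹ : Carrier
    t⁻¹ = proj₁ (inverse t t≉0)

    t*t⁻¹≈1 : t * t⁻¹ ≈ 1#
    t*t⁻¹≈1 = proj₂ (inverse t t≉0)

    t⁻¹*t≈1 : t⁻¹ * t ≈ 1#
    t⁻¹*t≈1 = trans (*-comm t⁻¹ t) t*t⁻¹≈1

    upper₂ upper₂⁻¹ : M₂
    upper₂   = m₂ t 1# 0# (- t⁻¹)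
    upper₂⁻¹ = m₂ t⁻¹ 1# 0# (- t)

    x*1+1*-x≈0 : ∀ x → x * 1# + 1# * (- x) ≈ 0#
    x*1+1*-x≈0 x = trans (+-cong (*-identityʳ x) (*-identityˡ (- x))) (-‿inverseʳ x)

    -x*-y≈xy : ∀ x y → - x * - y ≈ x * y
    -x*-y≈xy x y = trans (sym (-‿distribˡ-* x (- y))) (trans (-‿cong (sym (-‿distribʳ-* x y))) (-‿involutive (x * y)))

    upper₂-inverse : ∀ a b → a * b ≈ 1# → b * a ≈ 1# → m₂ a 1# 0# (- b) ⊙ m₂ b 1# 0# (- a) ≈₂ I₂
    upper₂-inverse a b a*b≈1 _ =
      ≈₂⟨ trans (+-cong a*b≈1 (zeroʳ 1#)) (+-identityʳ 1#) , x*1+1*-x≈0 a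
        , trans (+-cong (zeroˡ b) (zeroʳ (- b))) (+-identityʳ 0#)
        , trans (+-cong (zeroˡ 1#) (trans (-x*-y≈xy b a) (trans (*-comm b a) a*b≈1))) (+-identityˡ 1#) ⟩

    E-upper₂∈B : IsB (E upper₂)
    E-upper₂∈B = mkB (Inv-E (mkInv₂ upper₂⁻¹ (upper₂-inverse t t⁻¹ t*t⁻¹≈1 t⁻¹*t≈1) (upper₂-inverse t⁻¹ t t⁻¹*t≈1 t*t⁻¹≈1)))
                     (E-upper upper₂ refl)

    factorisation₂ : swap₂ ⊙ (lower₂ t⁻¹ ⊙ upper₂) ≈₂ lower₂ t
    factorisation₂ = ≈₂⟨ trans (+-cong (zeroˡ _) (trans (*-identityˡ _) a₂₁≈1)) (+-identityˡ 1#)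
                       , trans (+-cong (zeroˡ _) (trans (*-identityˡ _) (x*1+1*-x≈0 t⁻¹))) (+-identityˡ 0#)
                       , trans (+-cong (trans (*-identityˡ _) a₁₁≈t) (zeroˡ _)) (+-identityʳ t)
                       , trans (+-cong (trans (*-identityˡ _) a₁₂≈1) (zeroˡ _)) (+-identityʳ 1#) ⟩
      where
      a₁₁≈t : 1# * t + 0# * 0# ≈ t
      a₁₁≈t = trans (+-cong (*-identityˡ t) (zeroˡ 0#)) (+-identityʳ t)
      a₁₂≈1 : 1# * 1# + 0# * (- t⁻¹) ≈ 1#
      a₁₂≈1 = trans (+-cong (*-identityˡ 1#) (zeroˡ (- t⁻¹))) (+-identityʳ 1#)
      a₂₁≈1 : t⁻¹ * t + 1# * 0# ≈ 1#
      a₂₁≈1 = trans (+-cong t⁻¹*t≈1 (zeroʳ 1#)) (+-identityʳ 1#)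

    f≋sM·f·E : f i t ≋ sM i · (f i t⁻¹ · E upper₂)
    f≋sM·f·E = ≋-sym (begin
      sM i · (f i t⁻¹ · E upper₂)          ≈⟨ ·-cong sM≋E-swap₂ (·-congʳ (E upper₂) (f≋E-lower₂ t⁻¹)) ⟩
      E swap₂ · (E (lower₂ t⁻¹) · E upper₂) ≈⟨ ·-congˡ (E swap₂) (E-⊙ (lower₂ t⁻¹) upper₂) ⟩
      E swap₂ · E (lower₂ t⁻¹ ⊙ upper₂)     ≈⟨ E-⊙ swap₂ (lower₂ t⁻¹ ⊙ upper₂) ⟩
      E (swap₂ ⊙ (lower₂ t⁻¹ ⊙ upper₂))     ≈⟨ E-cong factorisation₂ ⟩
      E (lower₂ t)                          ≈⟨ f≋E-lower₂ t ⟨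
      f i t                                 ∎)

  Cell-·f-descent : ∀ σ {L} t → ¬ t ≈ 0# → Descent σ → IsB⁻ L → Cell (σ s i) ((L · P σ) · f i t)
  Cell-·f-descent σ {L} t t≉0 descent L∈B⁻ =
    Cell-resp-∼ (Cell-·f-ascent (σ s i) t⁻¹ (descent⇒ascent-σs {σ} descent) L∈B⁻) (mk∼ E-upper₂∈B (≋-sym factorised))
    where
    open FactorLower t t≉0
    factorised : ((L · P (σ s i)) · f i t⁻¹) · E upper₂ ≋ (L · P σ) · f i t
    factorised = begin
      ((L · P (σ s i)) · f i t⁻¹) · E upper₂  ≈⟨ ·-assoc (L · P (σ s i)) (f i t⁻¹) (E upper₂) ⟩
      (L · P (σ s i)) · (f i t⁻¹ · E upper₂)  ≈⟨ ·-congʳ (f i t⁻¹ · E upper₂) (L·P·sM≋L·Pσs σ L) ⟨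
      ((L · P σ) · sM i) · (f i t⁻¹ · E upper₂) ≈⟨ ·-assoc (L · P σ) (sM i) (f i t⁻¹ · E upper₂) ⟩
      (L · P σ) · (sM i · (f i t⁻¹ · E upper₂)) ≈⟨ ·-congˡ (L · P σ) f≋sM·f·E ⟨
      (L · P σ) · f i t                      ∎

  -- Comparing the entries (σ k , σ s_i k), k ∈ {i₁ , i₂}, of L · P (σ s i) = P σ · U: one of them lies
  -- strictly above the diagonal, where L vanishes, while the diagonal of U does not.
  B⁻Pσs∩PσB-empty : ∀ σ {L U} → IsB⁻ L → IsB U → ¬ (L · P (σ s i) ≋ P σ · U)
  B⁻Pσs∩PσB-empty σ {L} {U} L∈B⁻ U∈B L·Pσs≋Pσ·U = byOrder (FinP.<-cmp (σ ⟨$⟩ʳ i₁) (σ ⟨$⟩ʳ i₂))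
    where
    U≈L : ∀ k j → U k j ≈ L (σ ⟨$⟩ʳ k) ((σ s i) ⟨$⟩ʳ j)
    U≈L k j = trans (sym (P·-entry-σ σ U k j)) (trans (sym (entry L·Pσs≋Pσ·U (σ ⟨$⟩ʳ k) j)) (·P-entry L (σ s i) (σ ⟨$⟩ʳ k) j))
    byOrder : Tri (Ascent σ) (σ ⟨$⟩ʳ i₁ ≡ σ ⟨$⟩ʳ i₂) (Descent σ) → ⊥
    byOrder (tri< ascent _ _) = IsB-diagonal≉0 U∈B i₁
      (trans (U≈L i₁ i₁) (trans (reflexive (≡.cong (L (σ ⟨$⟩ʳ i₁)) (σs-i₁ σ))) (lowerB⁻ L∈B⁻ _ _ ascent)))
    byOrder (tri> _ _ descent) = IsB-diagonal≉0 U∈B i₂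
      (trans (U≈L i₂ i₂) (trans (reflexive (≡.cong (L (σ ⟨$⟩ʳ i₂)) (σs-i₂ σ))) (lowerB⁻ L∈B⁻ _ _ descent)))
    byOrder (tri≈ _ σi₁≡σi₂ _) =
      i₁≢i₂ (≡.trans (≡.sym (Perm.inverseˡ σ)) (≡.trans (≡.cong (σ ⟨$⟩ˡ_) σi₁≡σi₂) (Perm.inverseˡ σ)))

  Cell-disjoint : ∀ σ {x y} → Cell σ x → Cell (σ s i) y → ¬ x ∼ y
  Cell-disjoint σ {x} (mkCell {L₁} {U₁} L₁∈B⁻ U₁∈B x≋L₁PU₁) (mkCell {L₂} {U₂} L₂∈B⁻ U₂∈B y≋L₂PU₂) (mk∼ {b} b∈B y≋x·b) =
    B⁻Pσs∩PσB-empty σ (IsB⁻-· (IsB⁻-inverse L₁∈B⁻) L₂∈B⁻) (IsB-· (IsB-· U₁∈B b∈B) (IsB-inverse U₂∈B)) (begin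
      (L₁⁻¹ · L₂) · P (σ s i)                    ≈⟨ ·-assoc L₁⁻¹ L₂ (P (σ s i)) ⟩
      L₁⁻¹ · (L₂ · P (σ s i))                    ≈⟨ ·-congˡ L₁⁻¹ (·-cancelʳ (L₂ · P (σ s i)) U₂ U₂⁻¹ (inverseʳ (invB U₂∈B))) ⟨
      L₁⁻¹ · (((L₂ · P (σ s i)) · U₂) · U₂⁻¹)    ≈⟨ ·-congˡ L₁⁻¹ (·-congʳ U₂⁻¹ (≋-trans (≋-sym y≋L₂PU₂) y≋x·b)) ⟩
      L₁⁻¹ · ((x · b) · U₂⁻¹)                    ≈⟨ ·-congˡ L₁⁻¹ (·-congʳ U₂⁻¹ (·-congʳ b x≋L₁PU₁)) ⟩
      L₁⁻¹ · ((((L₁ · P σ) · U₁) · b) · U₂⁻¹)    ≈⟨ ·-congˡ L₁⁻¹ (regroup (L₁ · P σ) U₁ b U₂⁻¹) ⟩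
      L₁⁻¹ · ((L₁ · P σ) · ((U₁ · b) · U₂⁻¹))    ≈⟨ ·-congˡ L₁⁻¹ (·-assoc L₁ (P σ) ((U₁ · b) · U₂⁻¹)) ⟩
      L₁⁻¹ · (L₁ · (P σ · ((U₁ · b) · U₂⁻¹)))    ≈⟨ ·-cancelˡ L₁⁻¹ L₁ _ (inverseˡ (invB⁻ L₁∈B⁻)) ⟩
      P σ · ((U₁ · b) · U₂⁻¹)                    ∎)
    where
    L₁⁻¹ U₂⁻¹ : Mat
    L₁⁻¹ = inv (invB⁻ L₁∈B⁻)
    U₂⁻¹ = inv (invB U₂∈B)
    regroup : ∀ A B C D → ((A · B) · C) · D ≋ A · ((B · C) · D)
    regroup A B C D = ≋-trans (·-congʳ D (·-assoc A B C)) (·-assoc A (B · C) D)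

module HeckeAction {c ℓ : Level} (F : FiniteField c ℓ) (m : ℕ) (i : Fin m) where
  open FiniteField F using (size; nonzero)
  open Hecke F m
  open Matrices F m
  open Cosets F m
  open Block F m i
  open ProjectiveLine F m i
  open NonzeroElements F
  open HeckeLine F m i
  open BruhatCells F m i
  open SetoidLists ∼-setoid

  module OnCoset {σ h} (h-cell : Cell σ h) where
    g : Mat
    g = lowerPart h-cell · P σ

    g∼h : g ∼ h
    g∼h = mk∼ (upperPart∈B h-cell) (decomposition h-cell)

    g-inv : Inv g
    g-inv = Cell⇒Inv (Cell-b⁻P {σ} (lowerPart∈B⁻ h-cell))

    g·mat∈σs : Descent σ → ∀ p → Nontrivial p → Cell (σ s i) (g · mat p)
    g·mat∈σs descent swap      _   = Cell-·sM σ (lowerPart∈B⁻ h-cell)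
    g·mat∈σs descent (lower t) t≉0 = Cell-·f-descent σ t t≉0 descent (lowerPart∈B⁻ h-cell)

    T₁-descent : Descent σ → All (Cell (σ s i)) (T₁ i h)
    T₁-descent descent = T₁-All _ h (λ p p-nontrivial →
      let p′ , p′-nontrivial , g·p′∼h·p = ∼·mat∼·mat g∼h p p-nontrivial
      in Cell-resp-∼ (g·mat∈σs descent p′ p′-nontrivial) g·p′∼h·p)

    others : List Mat
    others = map (λ t → g · f i t) nonzero

    T₁-ascent : T₁ i h ↭ g · sM i ∷ others
    T₁-ascent = T₁-resp-∼ (Cell⇒Inv h-cell) (∼-sym g∼h)

    g·sM∈σs : Cell (σ s i) (g · sM i)
    g·sM∈σs = Cell-·sM σ (lowerPart∈B⁻ h-cell)

    others-cells : Ascent σ → All (Cell σ) others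
    others-cells ascent = AllProperties.map⁺ (All.universal (λ t → Cell-·f-ascent σ t ascent (lowerPart∈B⁻ h-cell)) nonzero)

    others-unique : Unique others
    others-unique = AllPairs.tail (T₁-unique g-inv)

    length-others : length others ≡ size ∸ 1
    length-others = ≡.trans (List.length-map (λ t → g · f i t) nonzero) (≡.cong (_∸ 1) (≡.sym size≡1+length-nonzero))

  record Representatives (σ : Permutation′ n) (R : List Mat) : Set (c ⊔ ℓ) where
    field
      cells    : All (Cell σ) R
      unique   : Unique R
      complete : ∀ g → Cell σ g → g ∈ R
  open Representatives

  Reps⇒Representatives : ∀ {σ R} → Reps σ R → Representatives σ R
  Reps⇒Representatives (R-cells , R-unique , R-complete) = record
    { cells    = All.map InCell⇒Cell R-cells
    ; unique   = AllPairs.map (λ r≁r′ r∼r′ → r≁r′ (∼⇒~ r∼r′)) R-unique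
    ; complete = λ g g-cell → Any.map ~⇒∼ (R-complete g (Cell⇒InCell g-cell)) }

  Representatives-σss : ∀ {σ R} → Representatives σ R → Representatives ((σ s i) s i) R
  Representatives-σss {σ} R-reps = record
    { cells    = All.map (Cell-cong (λ j → ≡.sym (σss≗σ σ j))) (cells R-reps)
    ; unique   = unique R-reps
    ; complete = λ g g-cell → complete R-reps g (Cell-cong (σss≗σ σ) g-cell) }

  Line-resp-∼ : ∀ {x y} → Inv x → x ∼ y → Line x ↭ Line y
  Line-resp-∼ x-inv x∼y = Homogeneous.prep x∼y (T₁-resp-∼ x-inv x∼y)

  -- Lines partition G/B.
  ∈-Line-of-shared-point : ∀ {r r′} → Inv r → Inv r′ → ∀ p p′ → r · mat p ∼ r′ · mat p′ → r′ ∈ Line r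
  ∈-Line-of-shared-point {r} {r′} r-inv r′-inv p p′ r·p∼r′·p′ = ∈-resp-↭ (begin
    Line r′               ↭⟨ Line-·mat r′-inv p′ ⟨
    Line (r′ · mat p′)    ↭⟨ Line-resp-∼ (Inv-· r-inv (Inv-mat p)) r·p∼r′·p′ ⟨
    Line (r · mat p)      ↭⟨ Line-·mat r-inv p ⟩
    Line r                ∎) (here ∼-refl)
    where open PermutationReasoning

  Line∩Cell-descent : ∀ {σ r r′} → Descent σ → Cell σ r → Cell σ r′ → r′ ∈ Line r → r′ ∼ r
  Line∩Cell-descent descent r-cell r′-cell (here r′∼r)    = r′∼r
  Line∩Cell-descent {σ} descent r-cell r′-cell (there r′∈T₁r) = ⊥-elim
    (All.lookupWith (λ x-cell r′∼x → Cell-disjoint σ r′-cell x-cell r′∼x) (OnCoset.T₁-descent r-cell descent) r′∈T₁r)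

  T-descent : ∀ {σ R S} → Descent σ → Representatives σ R → Representatives (σ s i) S → T i R ↭ S
  T-descent {σ} {R} {S} descent R-reps S-reps = unique-⊆-⊇⇒↭ TR-unique (unique S-reps) TR⊆S S⊆TR
    where
    T₁-disjoint : ∀ {r r′} → Cell σ r → Cell σ r′ → ¬ r ∼ r′ → All (λ x → All (λ y → ¬ x ∼ y) (T₁ i r′)) (T₁ i r)
    T₁-disjoint {r} {r′} r-cell r′-cell r≁r′ = T₁-All _ r (λ p _ → T₁-All _ r′ (λ p′ _ r·p∼r′·p′ →
      r≁r′ (∼-sym (Line∩Cell-descent descent r-cell r′-cell
        (∈-Line-of-shared-point (Cell⇒Inv r-cell) (Cell⇒Inv r′-cell) p p′ r·p∼r′·p′)))))
    TR-unique : Unique (T i R)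
    TR-unique = AllPairsProperties.concat⁺ (AllProperties.map⁺ (All.map (T₁-unique ∘ Cell⇒Inv) (cells R-reps)))
                  (AllPairsProperties.map⁺ (AllPairs-mapWithAll T₁-disjoint (cells R-reps) (unique R-reps)))
    TR⊆S : All (_∈ S) (T i R)
    TR⊆S = AllProperties.concat⁺ (AllProperties.map⁺
             (All.map (λ r-cell → All.map (complete S-reps _) (OnCoset.T₁-descent r-cell descent)) (cells R-reps)))
    S⊆TR : All (_∈ T i R) S
    S⊆TR = All.map (λ {y} y-cell → AnyProperties.concat⁺ (AnyProperties.map⁺ (Any.map (y∈T₁ y-cell) (g∈R y-cell))))
                   (cells S-reps)
      where
      g∈R : ∀ {y} (y-cell : Cell (σ s i) y) → lowerPart y-cell · P σ ∈ R
      g∈R y-cell = complete R-reps _ (Cell-b⁻P {σ} (lowerPart∈B⁻ y-cell))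
      y∈T₁ : ∀ {y r} (y-cell : Cell (σ s i) y) → lowerPart y-cell · P σ ∼ r → y ∈ T₁ i r
      y∈T₁ {y} y-cell g∼r = ∈-resp-↭ (T₁-resp-∼ (Cell⇒Inv (Cell-b⁻P {σ} (lowerPart∈B⁻ y-cell))) g∼r)
        (here (∼-sym (mk∼ (upperPart∈B y-cell) (≋-trans (decomposition y-cell)
          (·-congʳ (upperPart y-cell) (≋-sym (L·P·sM≋L·Pσs σ (lowerPart y-cell))))))))

  T-resp-↭ : ∀ {xs ys} → All Inv xs → xs ↭ ys → T i xs ↭ T i ys
  T-resp-↭ = concatMap-resp-↭ (T₁ i) (λ x∼y x-inv → Inv-resp-∼ x-inv x∼y) T₁-resp-∼

  T-ascent : ∀ {σ R S} → Ascent σ → Representatives σ R → Representatives (σ s i) S →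
             T i R ↭ size times S ++ (size ∸ 1) times R
  T-ascent {σ} {R} {S} ascent R-reps S-reps = begin
    T i R
      ↭⟨ T-resp-↭ R-inv (↭-sym TS↭R) ⟩
    T i (T i S)
      ≡⟨ concatMap-concatMap (T₁ i) (T₁ i) S ⟩
    concatMap (λ x → T i (T₁ i x)) S
      ↭⟨ concatMap⁺ S (All.map (T-T₁ ∘ Cell⇒Inv) (cells S-reps)) ⟩
    concatMap (λ x → size times [ x ] ++ (size ∸ 1) times T₁ i x) S
      ↭⟨ concatMap-++ (λ x → size times [ x ]) (λ x → (size ∸ 1) times T₁ i x) S ⟩
    concatMap (λ x → size times [ x ]) S ++ concatMap (λ x → (size ∸ 1) times T₁ i x) S
      ↭⟨ ++⁺ (concatMap-times size [_] S) (concatMap-times (size ∸ 1) (T₁ i) S) ⟩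
    size times concatMap [_] S ++ (size ∸ 1) times T i S
      ≡⟨ ≡.cong (λ xs → size times xs ++ (size ∸ 1) times T i S) (List.concatMap-pure S) ⟩
    size times S ++ (size ∸ 1) times T i S
      ↭⟨ ++⁺ˡ (size times S) (×-congʳ (size ∸ 1) TS↭R) ⟩
    size times S ++ (size ∸ 1) times R
      ∎
    where
    open PermutationReasoning
    R-inv : All Inv R
    R-inv = All.map Cell⇒Inv (cells R-reps)
    TS↭R : T i S ↭ R
    TS↭R = T-descent (ascent⇒descent-σs {σ} ascent) S-reps (Representatives-σss R-reps)

module HeckeActionInDefs {c ℓ : Level} (F : FiniteField c ℓ) (m : ℕ) (i : Fin m) where
  open FiniteField F using (size; nonzero)
  open Hecke F m
  open Matrices F m
  open Cosets F m
  open HeckeLine F m i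
  open BruhatCells F m i
  open HeckeAction F m i
  open SetoidLists ∼-setoid

  ↭⇒≐ : ∀ {xs ys} → xs ↭ ys → xs ≐ ys
  ↭⇒≐ = Homogeneous.map ∼⇒~

  unique⇒distinct : ∀ {xs} → Unique xs → AllPairs (λ a b → ¬ (a ~ b)) xs
  unique⇒distinct = AllPairs.map (λ a≁b a~b → a≁b (~⇒∼ a~b))

  ⊛≡times : ∀ k L → k ⊛ L ≡ k times L
  ⊛≡times zero    L = ≡.refl
  ⊛≡times (suc k) L = ≡.cong (L ++_) (⊛≡times k L)

  T-singleton : ∀ h → T i (h ∷ []) ≐ T₁ i h
  T-singleton h = ↭⇒≐ (↭-reflexive (List.++-identityʳ (T₁ i h)))

  coset-descent : ∀ {σ} h → InCell σ h → Descent σ →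
                  Σ (List Mat) λ gs → length gs ≡ size × All (InCell (σ s i)) gs
                    × AllPairs (λ a b → ¬ (a ~ b)) gs × (T i (h ∷ []) ≐ gs)
  coset-descent {σ} h h∈σ descent =
    T₁ i h , length-T₁ h , All.map Cell⇒InCell (T₁-descent descent)
    , unique⇒distinct (T₁-unique (Cell⇒Inv h-cell)) , T-singleton h
    where
    h-cell : Cell σ h
    h-cell = InCell⇒Cell {σ} h∈σ
    open OnCoset h-cell

  coset-ascent : ∀ {σ} h → InCell σ h → Ascent σ →
                 Σ Mat λ g → Σ (List Mat) λ hs → InCell (σ s i) g
                   × length hs ≡ size ∸ 1 × All (InCell σ) hs
                   × AllPairs (λ a b → ¬ (a ~ b)) hs × (T i (h ∷ []) ≐ (g ∷ hs))
  coset-ascent {σ} h h∈σ ascent =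
    g · sM i , others , Cell⇒InCell g·sM∈σs , length-others , All.map Cell⇒InCell (others-cells ascent)
    , unique⇒distinct others-unique , Homogeneous.trans (T-singleton h) (↭⇒≐ T₁-ascent)
    where open OnCoset (InCell⇒Cell {σ} h∈σ)

  sum-descent : ∀ {σ R S} → Reps σ R → Reps (σ s i) S → Descent σ → T i R ≐ S
  sum-descent {σ} R-reps S-reps descent = ↭⇒≐ (T-descent {σ} descent (Reps⇒Representatives R-reps) (Reps⇒Representatives S-reps))

  sum-ascent : ∀ {σ R S} → Reps σ R → Reps (σ s i) S → Ascent σ → T i R ≐ ((size ⊛ S) ++ ((size ∸ 1) ⊛ R))
  sum-ascent {σ} {R} {S} R-reps S-reps ascent =
    ≡.subst₂ (λ xs ys → T i R ≐ (xs ++ ys)) (≡.sym (⊛≡times size S)) (≡.sym (⊛≡times (size ∸ 1) R))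
      (↭⇒≐ (T-ascent {σ} ascent (Reps⇒Representatives R-reps) (Reps⇒Representatives S-reps)))

lemma3p5 : ∀ {c ℓ : Level} (F : FiniteField c ℓ) → IsPrimePower (FiniteField.size F) →
    ∀ (m : ℕ) (σ : Permutation′ (suc m)) (i : Fin m) →
    let open FiniteField F using (size) in
    let open Hecke F m in
    (∀ (h : Mat) → InCell σ h →
      ((σ ⟨$⟩ʳ fsuc i) < (σ ⟨$⟩ʳ inject₁ i) →
        Σ (List Mat) λ gs → length gs ≡ size × All (InCell (σ s i)) gs
          × AllPairs (λ a b → ¬ (a ~ b)) gs × (T i (h ∷ []) ≐ gs))
      × ((σ ⟨$⟩ʳ inject₁ i) < (σ ⟨$⟩ʳ fsuc i) →
        Σ Mat λ g → Σ (List Mat) λ hs → InCell (σ s i) g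
          × length hs ≡ size ∸ 1 × All (InCell σ) hs
          × AllPairs (λ a b → ¬ (a ~ b)) hs × (T i (h ∷ []) ≐ (g ∷ hs))))
    × (∀ (R S : List Mat) → Reps σ R → Reps (σ s i) S →
      ((σ ⟨$⟩ʳ fsuc i) < (σ ⟨$⟩ʳ inject₁ i) → T i R ≐ S)
      × ((σ ⟨$⟩ʳ inject₁ i) < (σ ⟨$⟩ʳ fsuc i) →
        T i R ≐ ((size ⊛ S) ++ ((size ∸ 1) ⊛ R))))
lemma3p5 F _ m σ i =
  (λ h h∈σ → coset-descent {σ} h h∈σ , coset-ascent {σ} h h∈σ) ,
  (λ R S R-reps S-reps → sum-descent {σ} R-reps S-reps , sum-ascent {σ} R-reps S-reps)
  where open HeckeActionInDefs F m i
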